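{- Let $T_1$ be the tanglegram of size $4$ whose left tree is the caterpillar $(((a,b),c),d)$ and whose right tree is the caterpillar $(((a,d),c),b)$, and let $T_2$ be the tanglegram of size $4$ whose left tree is $((a,b),(c,d))$ and whose right tree is $((a,c),(b,d))$, where in both cases the leaf of the left tree labelled $x$ is matched to the leaf of the right tree labelled $x$. Then the crossing-critical tanglegrams are exactly $T_1$ and $T_2$, i.e., a tanglegram is crossing-critical if and only if it equals $T_1$ or $T_2$. Consequently, every non-planar tanglegram contains $T_1$ or $T_2$ as an induced subtanglegram.
   Context: A plane binary tree is a rooted tree in which every vertex has either two ordered children (up and down) or none (a leaf); a single vertex is allowed. A tanglegram layout $(L,R,\sigma)$ consists of a plane binary tree $L$ with root $r$ drawn in the half-plane $x\le 0$ with its leaves on the line $x=0$, a plane binary tree $R$ with root $\rho$ drawn in $x\ge 1$ with its leaves on the line $x=1$, both with $n$ leaves, and a perfect matching $\sigma$ between the two leaf sets drawn as straight segments (the matching edges). A switch at an internal vertex $v$ of $L$ or $R$ interchanges the up- and down-subtrees of $v$ (matching edges move with their leaves). A tanglegram is an equivalence class of layouts under sequences of switches; equivalently, a pair of rooted (unordered) binary trees with a bijection between their leaf sets, up to isomorphism; interchanging $L$ and $R$ is not allowed. The size is $n$. Notation such as $(((a,b),c),d)$ denotes the rooted binary tree whose root has children leaf $d$ and a vertex whose children are leaf $c$ and a vertex with children leaves $a,b$. A tanglegram is planar if it has a layout in which no two matching edges cross, non-planar otherwise. For a set $E$ of matching edges, the subtanglegram induced by $E$ is obtained by taking in each tree the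 smallest subtree containing the leaves incident to $E$, rooting it at its vertex closest to the original root, suppressing all degree-2 non-root vertices, and keeping the matching edges of $E$. A tanglegram is crossing-critical if it is non-planar but every proper induced subtanglegram of it is planar. -}

module Defs where

open import Data.Nat using (ℕ)
open import Data.Fin using (Fin; zero; suc)
open import Data.Fin.Subset using (Subset; _∈_; _∉_)
open import Data.Fin.Subset.Properties using (_∈?_)
open import Data.List using (List; []; _∷_; _++_; allFin)
open import Data.List.Membership.Propositional using () renaming (_∈_ to _∈ₗ_)
open import Data.List.Relation.Binary.Permutation.Propositional
  using (_↭_; refl; prep; swap; trans)
open import Data.Maybe using (Maybe; just; nothing)
open import Data.Product using (Σ; Σ-syntax; ∃; ∃-syntax; _×_; _,_)
open import Data.Empty using (⊥)
open import Function.Bundles using (_↔_; Inverse)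
open import Function.Definitions using (Injective)
open import Relation.Nullary using (¬_; yes; no)
open import Relation.Binary.PropositionalEquality using (_≡_; refl)

-- Plane (ordered) binary trees with labelled leaves.
-- node u d : u is the up-subtree, d is the down-subtree.

data BT (A : Set) : Set where
  leaf : A → BT A
  node : BT A → BT A → BT A

map : {A B : Set} → (A → B) → BT A → BT B
map f (leaf x)   = leaf (f x)
map f (node u d) = node (map f u) (map f d)

-- leaves read from top to bottom along the line x = 0 (resp. x = 1)
leaves : {A : Set} → BT A → List A
leaves (leaf x)   = x ∷ []
leaves (node u d) = leaves u ++ leaves d

-- Equivalence generated by switches (interchanging up/down subtrees
-- at internal vertices): two plane trees are related iff one is
-- obtained from the other by a sequence of switches.
data _∼_ {A : Set} : BT A → BT A → Set where
  leaf : ∀ {x} → leaf x ∼ leaf x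
  node : ∀ {a b c d} → a ∼ c → b ∼ d → node a b ∼ node c d
  swap : ∀ {a b c d} → a ∼ d → b ∼ c → node a b ∼ node c d

-- Tanglegrams of size n: the leaves of each tree are labelled by Fin n,
-- every label occurring exactly once; the matching joins the left leaf
-- labelled i with the right leaf labelled i (matching edge i).

record Tanglegram (n : ℕ) : Set where
  constructor tg
  field
    L   : BT (Fin n)
    R   : BT (Fin n)
    L-ok : leaves L ↭ allFin n
    R-ok : leaves R ↭ allFin n
open Tanglegram public

-- Equality of tanglegrams: isomorphism (relabel the matching edges by a
-- bijection, and apply switches in both trees; L and R are not swapped).
_≅_ : {n m : ℕ} → Tanglegram n → Tanglegram m → Set
_≅_ {n} {m} T T' =
  Σ[ π ∈ Fin n ↔ Fin m ]
    (map (Inverse.to π) (L T) ∼ L T') × (map (Inverse.to π) (R T) ∼ R T')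

data Before {A : Set} (i j : A) : List A → Set where
  here  : ∀ {xs} → j ∈ₗ xs → Before i j (i ∷ xs)
  there : ∀ {x xs} → Before i j xs → Before i j (x ∷ xs)

Crosses : {A : Set} → BT A → BT A → A → A → Set
Crosses L' R' i j = Before i j (leaves L') × Before j i (leaves R')

PlanarPair : {A : Set} → BT A → BT A → Set
PlanarPair {A} L₀ R₀ =
  Σ[ L' ∈ BT A ] Σ[ R' ∈ BT A ]
    (L₀ ∼ L') × (R₀ ∼ R') × (∀ i j → ¬ Crosses L' R' i j)

Planar : {n : ℕ} → Tanglegram n → Set
Planar T = PlanarPair (L T) (R T)

-- Induced subtrees: smallest subtree containing the leaves in E, rooted
-- at its vertex closest to the root, degree-2 vertices suppressed.

restrict : {n : ℕ} → Subset n → BT (Fin n) → Maybe (BT (Fin n))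
restrict E (leaf x) with x ∈? E
... | yes _ = just (leaf x)
... | no  _ = nothing
restrict E (node u d) with restrict E u | restrict E d
... | just u' | just d' = just (node u' d')
... | just u' | nothing = just u'
... | nothing | just d' = just d'
... | nothing | nothing = nothing

CrossingCritical : {n : ℕ} → Tanglegram n → Set
CrossingCritical {n} T =
  ¬ Planar T ×
  (∀ (E : Subset n) (L' R' : BT (Fin n)) →
     (∃[ i ] i ∉ E) →
     restrict E (L T) ≡ just L' → restrict E (R T) ≡ just R' →
     PlanarPair L' R')

InducedSub : {k n : ℕ} → Tanglegram k → Tanglegram n → Set
InducedSub {k} {n} T' T =
  Σ[ E ∈ Subset n ] Σ[ f ∈ (Fin k → Fin n) ]
    Injective _≡_ _≡_ f ×
    (∀ j → f j ∈ E) × (∀ i → i ∈ E → ∃[ j ] f j ≡ i) ×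
    (Σ[ L₀ ∈ BT (Fin n) ] restrict E (L T) ≡ just L₀ × map f (L T') ∼ L₀) ×
    (Σ[ R₀ ∈ BT (Fin n) ] restrict E (R T) ≡ just R₀ × map f (R T') ∼ R₀)

private
  a b c d : Fin 4
  a = zero
  b = suc zero
  c = suc (suc zero)
  d = suc (suc (suc zero))

T₁ : Tanglegram 4
T₁ = tg (node (node (node (leaf a) (leaf b)) (leaf c)) (leaf d))
        (node (node (node (leaf a) (leaf d)) (leaf c)) (leaf b))
        refl
        (prep a (trans (swap d c refl) (trans (prep c (swap d b refl)) (swap c b refl))))

T₂ : Tanglegram 4
T₂ = tg (node (node (leaf a) (leaf b)) (node (leaf c) (leaf d)))
        (node (node (leaf a) (leaf c)) (node (leaf b) (leaf d)))
        refl
        (prep a (swap c b refl))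

-- By induction on the number of leaves, two trees on the same leaf set either have a common leaf
-- order realisable by switches in both (a planar layout) or induce T₁ or T₂ on four leaves.
-- If the left root has two children with at least two leaves each, let X be the leaves of the
-- upper one. Either two sibling subtrees of the right tree both meet X and its complement, which
-- gives T₂, or some vertex w separates X from its complement; then, for α below w in X and β
-- below w outside X, common layouts τβ of the restriction to X ∪ {β} and αυ of the restriction
-- to {α} ∪ ∁X glue to the common layout τυ. Otherwise both roots carry a pendant leaf: equal
-- pendants reduce to the rest of the trees, and crossed pendants lead to T₁ or to a similar gluing.
-- A crossing-critical tanglegram is therefore the copy of T₁ or T₂ it induces; conversely T₁ and
-- T₂ are non-planar, while their proper induced subtanglegrams have too few leaves to induce either.
module Submission where

open import Defs
open import Data.Nat using (ℕ; zero; suc; _+_; _≤_; _<_)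
open import Data.Nat.Properties using (≤-refl; <-≤-trans; ≤-pred; +-comm; +-mono-<-≤)
open import Data.Fin using (Fin; zero; suc; punchOut) renaming (_<_ to _<ᶠ_)
open import Data.Fin.Properties using (punchOut-injective; pigeonhole; <⇒≢; any?) renaming (_≟_ to _≟F_)
open import Data.Fin.Subset using (Subset; _∈_; _∉_; ⁅_⁆; _∪_) renaming (⊥ to ∅)
open import Data.Fin.Subset.Properties using (_∈?_; x∈p∪q⁻; x∈p∪q⁺; x∈⁅x⁆; x∈⁅y⁆⇒x≡y; ∉⊥)
open import Data.List using (List; []; _∷_; _++_; filter; length; reverse; allFin; concatMap) renaming (map to lmap)
open import Data.List.Properties
  using ( ++-assoc; ++-identityʳ; filter-++; filter-notAll; filter-none; length-filter; ∷ʳ-injective; ∷-injective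
        ; reverse-++; unfold-reverse; map-++)
open import Data.List.Membership.Propositional using () renaming (_∈_ to _∈ₗ_; _∉_ to _∉ₗ_)
open import Data.List.Membership.Propositional.Properties
  using (∈-++⁺ˡ; ∈-++⁺ʳ; ∈-++⁻; ∈-filter⁺; ∈-filter⁻; ∈-map⁺; ∈-map⁻; ∈-allFin; ∈-concatMap⁺)
open import Data.List.Relation.Unary.Any as Any using (here; there)
open import Data.List.Relation.Unary.All as All using (All)
import Data.List.Relation.Unary.All.Properties as All
open import Data.List.Relation.Unary.AllPairs using ([]; _∷_)
open import Data.List.Relation.Unary.Unique.Propositional using (Unique)
open import Data.List.Relation.Unary.Unique.Propositional.Properties using (filter⁺; allFin⁺)
open import Data.List.Relation.Binary.Permutation.Propositional
  using (_↭_; ↭-refl; ↭-sym; ↭-trans; ↭⇒↭ₛ)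
open import Data.List.Relation.Binary.Permutation.Propositional.Properties
  using (∈-resp-↭; ↭-length) renaming (++⁺ to ↭-++⁺; ++-comm to ↭-++-comm)
import Data.List.Relation.Binary.Permutation.Setoid.Properties as SetoidPermutation
open import Data.Maybe using (Maybe; just; nothing)
open import Data.Maybe.Properties using (just-injective)
open import Data.Product using (Σ-syntax; ∃₂; ∃-syntax; _×_; _,_; proj₁; proj₂)
open import Data.Sum as Sum using (_⊎_; inj₁; inj₂; [_,_]; [_,_]′)
open import Data.Empty using (⊥; ⊥-elim)
open import Data.Unit using (⊤; tt)
open import Function using (_∘_)
open import Function.Bundles using (_⇔_; _↔_; Inverse; mk⇔; mk↔ₛ′)
open import Function.Definitions using (Injective)
open import Relation.Nullary using (¬_; yes; no; Dec)
open import Relation.Nullary.Decidable using (toWitness; toSum; _×-dec_)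
open import Relation.Binary.PropositionalEquality using (_≡_; _≢_; ≢-sym; refl; sym; trans; cong; cong₂; subst; setoid)

private variable
  n : ℕ
  A : Set

∈-resp-≡ : {z w : A} {xs : List A} → z ≡ w → z ∈ₗ xs → w ∈ₗ xs
∈-resp-≡ refl m = m

Unique-resp-↭ : {xs ys : List A} → xs ↭ ys → Unique xs → Unique ys
Unique-resp-↭ p = SetoidPermutation.Unique-resp-↭ (setoid _) (↭⇒↭ₛ p)

Unique-head-∉ : {x : A} {xs : List A} → Unique (x ∷ xs) → x ∉ₗ xs
Unique-head-∉ (x∉ ∷ _) m = All.lookup x∉ m refl

Unique-tail : {x : A} {xs : List A} → Unique (x ∷ xs) → Unique xs
Unique-tail (_ ∷ u) = u

Unique-++⁻ˡ : {xs ys : List A} → Unique (xs ++ ys) → Unique xs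
Unique-++⁻ˡ {xs = []} u = []
Unique-++⁻ˡ {xs = x ∷ xs} (x∉ ∷ u) = All.++⁻ˡ xs x∉ ∷ Unique-++⁻ˡ u

Unique-++⁻ʳ : {xs ys : List A} → Unique (xs ++ ys) → Unique ys
Unique-++⁻ʳ {xs = []} u = u
Unique-++⁻ʳ {xs = x ∷ xs} (_ ∷ u) = Unique-++⁻ʳ {xs = xs} u

Unique-++-disjoint : {xs ys : List A} {z : A} → Unique (xs ++ ys) → z ∈ₗ xs → z ∈ₗ ys → ⊥
Unique-++-disjoint {xs = x ∷ xs} (x∉ ∷ u) (here refl) m = All.lookup (All.++⁻ʳ xs x∉) m refl
Unique-++-disjoint {xs = x ∷ xs} (_ ∷ u) (there m₁) m = Unique-++-disjoint u m₁ m

Unique-++-≢ : {xs ys : List A} {x y : A} → Unique (xs ++ ys) → x ∈ₗ xs → y ∈ₗ ys → x ≢ y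
Unique-++-≢ u mx my refl = Unique-++-disjoint u mx my

fromList : List (Fin n) → Subset n
fromList [] = ∅
fromList (x ∷ xs) = ⁅ x ⁆ ∪ fromList xs

fromList⁺ : {z : Fin n} (xs : List (Fin n)) → z ∈ₗ xs → z ∈ fromList xs
fromList⁺ (x ∷ xs) (here refl) = x∈p∪q⁺ (inj₁ (x∈⁅x⁆ x))
fromList⁺ (x ∷ xs) (there m) = x∈p∪q⁺ (inj₂ (fromList⁺ xs m))

fromList⁻ : {z : Fin n} (xs : List (Fin n)) → z ∈ fromList xs → z ∈ₗ xs
fromList⁻ [] m = ⊥-elim (∉⊥ m)
fromList⁻ (x ∷ xs) m with x∈p∪q⁻ ⁅ x ⁆ (fromList xs) m
... | inj₁ p = here (x∈⁅y⁆⇒x≡y x p)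
... | inj₂ p = there (fromList⁻ xs p)

-- Switches and layouts

Tree : ℕ → Set
Tree n = BT (Fin n)

∼-refl : {t : BT A} → t ∼ t
∼-refl {t = leaf x} = leaf
∼-refl {t = node u d} = node ∼-refl ∼-refl

∼-sym : {t s : BT A} → t ∼ s → s ∼ t
∼-sym leaf = leaf
∼-sym (node p q) = node (∼-sym p) (∼-sym q)
∼-sym (swap p q) = swap (∼-sym q) (∼-sym p)

∼-trans : {t s r : BT A} → t ∼ s → s ∼ r → t ∼ r
∼-trans leaf leaf = leaf
∼-trans (node p q) (node r s) = node (∼-trans p r) (∼-trans q s)
∼-trans (node p q) (swap r s) = swap (∼-trans p r) (∼-trans q s)
∼-trans (swap p q) (node r s) = swap (∼-trans p s) (∼-trans q r)
∼-trans (swap p q) (swap r s) = node (∼-trans p s) (∼-trans q r)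

-- Layout t σ: σ is the top-to-bottom leaf sequence of some tree obtained from t by switches.
data Layout {A : Set} : BT A → List A → Set where
  leaf : ∀ {x} → Layout (leaf x) (x ∷ [])
  node : ∀ {u d σ τ} → Layout u σ → Layout d τ → Layout (node u d) (σ ++ τ)
  swap : ∀ {u d σ τ} → Layout u σ → Layout d τ → Layout (node u d) (τ ++ σ)

∼⇒Layout : {t s : BT A} → t ∼ s → Layout t (leaves s)
∼⇒Layout leaf = leaf
∼⇒Layout (node p q) = node (∼⇒Layout p) (∼⇒Layout q)
∼⇒Layout (swap p q) = swap (∼⇒Layout p) (∼⇒Layout q)

Layout⇒∼ : {t : BT A} {σ : List A} → Layout t σ → Σ[ s ∈ BT A ] (t ∼ s × leaves s ≡ σ)
Layout⇒∼ leaf = _ , leaf , refl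
Layout⇒∼ (node l₁ l₂) with Layout⇒∼ l₁ | Layout⇒∼ l₂
... | s₁ , p₁ , refl | s₂ , p₂ , refl = node s₁ s₂ , node p₁ p₂ , refl
Layout⇒∼ (swap l₁ l₂) with Layout⇒∼ l₁ | Layout⇒∼ l₂
... | s₁ , p₁ , refl | s₂ , p₂ , refl = node s₂ s₁ , swap p₁ p₂ , refl

Layout-resp-∼ : {t s : BT A} {σ : List A} → t ∼ s → Layout s σ → Layout t σ
Layout-resp-∼ leaf leaf = leaf
Layout-resp-∼ (node p q) (node l₁ l₂) = node (Layout-resp-∼ p l₁) (Layout-resp-∼ q l₂)
Layout-resp-∼ (node p q) (swap l₁ l₂) = swap (Layout-resp-∼ p l₁) (Layout-resp-∼ q l₂)
Layout-resp-∼ (swap p q) (node l₁ l₂) = swap (Layout-resp-∼ p l₂) (Layout-resp-∼ q l₁)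
Layout-resp-∼ (swap p q) (swap l₁ l₂) = node (Layout-resp-∼ p l₂) (Layout-resp-∼ q l₁)

Layout-reverse : {t : BT A} {σ : List A} → Layout t σ → Layout t (reverse σ)
Layout-reverse leaf = leaf
Layout-reverse (node {σ = σ} {τ} l₁ l₂) =
  subst (Layout _) (sym (reverse-++ σ τ)) (swap (Layout-reverse l₁) (Layout-reverse l₂))
Layout-reverse (swap {σ = σ} {τ} l₁ l₂) =
  subst (Layout _) (sym (reverse-++ τ σ)) (node (Layout-reverse l₁) (Layout-reverse l₂))

Layout-↭ : {t : BT A} {σ : List A} → Layout t σ → σ ↭ leaves t
Layout-↭ leaf = ↭-refl
Layout-↭ (node l₁ l₂) = ↭-++⁺ (Layout-↭ l₁) (Layout-↭ l₂)
Layout-↭ (swap {σ = σ} {τ} l₁ l₂) = ↭-trans (↭-++-comm τ σ) (↭-++⁺ (Layout-↭ l₁) (Layout-↭ l₂))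

Layout-∈ : {t : BT A} {σ : List A} {x : A} → Layout t σ → x ∈ₗ σ → x ∈ₗ leaves t
Layout-∈ l = ∈-resp-↭ (Layout-↭ l)

Layout-∈⁻ : {t : BT A} {σ : List A} {x : A} → Layout t σ → x ∈ₗ leaves t → x ∈ₗ σ
Layout-∈⁻ l = ∈-resp-↭ (↭-sym (Layout-↭ l))

Layout-unique : {t : BT A} {σ : List A} → Layout t σ → Unique (leaves t) → Unique σ
Layout-unique l = Unique-resp-↭ (↭-sym (Layout-↭ l))

Layout-nonempty : {t : BT A} {σ : List A} → Layout t σ → σ ≢ []
Layout-nonempty leaf ()
Layout-nonempty (node {σ = []} l₁ l₂) e = Layout-nonempty l₁ refl
Layout-nonempty (swap {τ = []} l₁ l₂) e = Layout-nonempty l₂ refl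

∼-∈ : {t s : BT A} {z : A} → t ∼ s → z ∈ₗ leaves t → z ∈ₗ leaves s
∼-∈ p = Layout-∈⁻ (∼⇒Layout p)

Before-∈ʳ : {i j : A} {xs : List A} → Before i j xs → j ∈ₗ xs
Before-∈ʳ (here m) = there m
Before-∈ʳ (there b) = there (Before-∈ʳ b)

Before-asym : {i j : A} {xs : List A} → Unique xs → Before i j xs → Before j i xs → ⊥
Before-asym (i∉ ∷ u) (here m) (here _) = All.lookup i∉ m refl
Before-asym (i∉ ∷ u) (here _) (there b) = All.lookup i∉ (Before-∈ʳ b) refl
Before-asym (j∉ ∷ u) (there b) (here _) = All.lookup j∉ (Before-∈ʳ b) refl
Before-asym (_ ∷ u) (there b) (there b′) = Before-asym u b b′

CommonLayout : BT A → BT A → Set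
CommonLayout {A} L′ R′ = Σ[ σ ∈ List A ] (Layout L′ σ × Layout R′ σ)

CommonLayout⇒PlanarPair : {L′ R′ : BT A} → Unique (leaves L′) → CommonLayout L′ R′ → PlanarPair L′ R′
CommonLayout⇒PlanarPair u (σ , lL , lR) with Layout⇒∼ lL | Layout⇒∼ lR
... | L″ , pL , refl | R″ , pR , eR = L″ , R″ , pL , pR , λ i j (c₁ , c₂) →
  Before-asym (Layout-unique lL u) c₁ (subst (Before j i) eR c₂)

split-∷ʳ : {β : A} (ys xs τ : List A) → ys ++ xs ≡ τ ++ β ∷ [] → xs ≢ [] →
  Σ[ xs′ ∈ List A ] (xs ≡ xs′ ++ β ∷ [] × τ ≡ ys ++ xs′)
split-∷ʳ [] xs τ e ne = τ , e , refl
split-∷ʳ (y ∷ []) [] [] e ne = ⊥-elim (ne refl)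
split-∷ʳ (y ∷ ys) xs (t ∷ τ) e ne with ∷-injective e
... | refl , e′ with split-∷ʳ ys xs τ e′ ne
... | xs′ , a , b = xs′ , a , cong (t ∷_) b
split-∷ʳ (y ∷ []) (_ ∷ _) [] ()
split-∷ʳ (y ∷ _ ∷ _) _ [] ()

split-∷ : {α : A} (xs ys υ : List A) → xs ++ ys ≡ α ∷ υ → xs ≢ [] →
  Σ[ xs′ ∈ List A ] (xs ≡ α ∷ xs′ × υ ≡ xs′ ++ ys)
split-∷ [] ys υ e ne = ⊥-elim (ne refl)
split-∷ (x ∷ xs) ys υ refl ne = xs , refl , refl

∈-∷ʳ : {β : A} (τ : List A) → β ∈ₗ (τ ++ β ∷ [])
∈-∷ʳ [] = here refl
∈-∷ʳ (x ∷ τ) = there (∈-∷ʳ τ)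

record NodeLayout {A : Set} (a b : BT A) (ρ : List A) : Set where
  constructor node-layout
  field
    σ τ : List A
    layoutˡ : Layout a σ
    layoutʳ : Layout b τ
    order : (ρ ≡ σ ++ τ) ⊎ (ρ ≡ τ ++ σ)

Layout-node⁻ : {a b : BT A} {ρ : List A} → Layout (node a b) ρ → NodeLayout a b ρ
Layout-node⁻ (node l₁ l₂) = node-layout _ _ l₁ l₂ (inj₁ refl)
Layout-node⁻ (swap l₁ l₂) = node-layout _ _ l₁ l₂ (inj₂ refl)

Layout-node-last : {a b : BT A} {τ : List A} {β : A} → Layout (node a b) (τ ++ β ∷ []) → β ∉ₗ leaves b →
  Σ[ σ ∈ List A ] Σ[ ρ ∈ List A ] (Layout a (σ ++ β ∷ []) × Layout b ρ × τ ≡ ρ ++ σ)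
Layout-node-last {τ = τ} l β∉b with Layout-node⁻ l
... | node-layout s₁ s₂ l₁ l₂ (inj₁ e) with split-∷ʳ s₁ s₂ τ (sym e) (Layout-nonempty l₂)
...   | s₂′ , refl , _ = ⊥-elim (β∉b (Layout-∈ l₂ (∈-∷ʳ s₂′)))
Layout-node-last {τ = τ} l β∉b | node-layout s₁ s₂ l₁ l₂ (inj₂ e) with split-∷ʳ s₂ s₁ τ (sym e) (Layout-nonempty l₁)
...   | s₁′ , refl , eτ = s₁′ , s₂ , l₁ , l₂ , eτ

Layout-node-first : {a b : BT A} {υ : List A} {α : A} → Layout (node a b) (α ∷ υ) → α ∉ₗ leaves b →
  Σ[ σ ∈ List A ] Σ[ ρ ∈ List A ] (Layout a (α ∷ σ) × Layout b ρ × υ ≡ σ ++ ρ)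
Layout-node-first {υ = υ} l α∉b with Layout-node⁻ l
... | node-layout s₁ s₂ l₁ l₂ (inj₁ e) with split-∷ s₁ s₂ υ (sym e) (Layout-nonempty l₁)
...   | s₁′ , refl , eυ = s₁′ , s₂ , l₁ , l₂ , eυ
Layout-node-first {υ = υ} l α∉b | node-layout s₁ s₂ l₁ l₂ (inj₂ e) with split-∷ s₂ s₁ υ (sym e) (Layout-nonempty l₂)
...   | s₂′ , refl , _ = ⊥-elim (α∉b (Layout-∈ l₂ (here refl)))

Layout-init : {a : BT A} {β : A} {τ : List A} → β ∉ₗ leaves a → Layout (node a (leaf β)) (τ ++ β ∷ []) → Layout a τ
Layout-init {τ = τ} β∉a l with Layout-node⁻ l
... | node-layout s₁ _ l₁ leaf (inj₁ e) with ∷ʳ-injective τ s₁ e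
...   | refl , _ = l₁
Layout-init {β = β} {τ} β∉a l | node-layout s₁ _ l₁ leaf (inj₂ e) with split-∷ʳ (β ∷ []) s₁ τ (sym e) (Layout-nonempty l₁)
...   | s₁′ , refl , _ = ⊥-elim (β∉a (Layout-∈ l₁ (∈-∷ʳ s₁′)))

Layout-tail : {b : BT A} {α : A} {υ : List A} → α ∉ₗ leaves b → Layout (node (leaf α) b) (α ∷ υ) → Layout b υ
Layout-tail α∉b l with Layout-node⁻ l
... | node-layout _ _ leaf l₂ (inj₁ refl) = l₂
Layout-tail {α = α} {υ} α∉b l | node-layout _ s₂ leaf l₂ (inj₂ e) with split-∷ s₂ (α ∷ []) υ (sym e) (Layout-nonempty l₂)
...   | _ , refl , _ = ⊥-elim (α∉b (Layout-∈ l₂ (here refl)))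

-- Reversing a common layout of both trees keeps it common, so the pendant leaf can be put last (or first).
layout-ending-with : {a R′ : BT A} {β : A} {σ : List A} → Layout (node a (leaf β)) σ → Layout R′ σ →
  Σ[ τ ∈ List A ] (Layout (node a (leaf β)) (τ ++ β ∷ []) × Layout R′ (τ ++ β ∷ []))
layout-ending-with (node l₁ leaf) lR = _ , node l₁ leaf , lR
layout-ending-with {β = β} (swap {σ = s₁} l₁ leaf) lR = reverse s₁ ,
  subst (Layout _) (unfold-reverse β s₁) (Layout-reverse (swap l₁ leaf)) , subst (Layout _) (unfold-reverse β s₁) (Layout-reverse lR)

layout-starting-with : {b R′ : BT A} {α : A} {σ : List A} → Layout (node (leaf α) b) σ → Layout R′ σ →
  Σ[ υ ∈ List A ] (Layout (node (leaf α) b) (α ∷ υ) × Layout R′ (α ∷ υ))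
layout-starting-with (node leaf l₂) lR = _ , node leaf l₂ , lR
layout-starting-with {α = α} (swap {τ = s₂} leaf l₂) lR = reverse s₂ ,
  subst (Layout _) (reverse-++ s₂ (α ∷ [])) (Layout-reverse (swap leaf l₂)) , subst (Layout _) (reverse-++ s₂ (α ∷ [])) (Layout-reverse lR)

layout-starting-with-pendant : {R₀ P : BT A} {d : A} {σ : List A} → Layout (node R₀ (leaf d)) σ → Layout P σ →
  Σ[ ρ ∈ List A ] (Layout P (d ∷ ρ) × Layout (node R₀ (leaf d)) (d ∷ ρ))
layout-starting-with-pendant lR lP with Layout-node⁻ lR
... | node-layout s₁ _ _ leaf (inj₂ refl) = s₁ , lP , lR
... | node-layout s₁ _ _ leaf (inj₁ refl) = reverse s₁ ,
  subst (Layout _) (reverse-++ s₁ (_ ∷ [])) (Layout-reverse lP) , subst (Layout _) (reverse-++ s₁ (_ ∷ [])) (Layout-reverse lR)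

cherry-first-layout : {R₀ Q : BT A} {d α b : A} {σ : List A} →
  Layout (node (node (node (leaf d) (leaf α)) Q) (leaf b)) σ → Layout (node R₀ (leaf d)) σ → d ≢ b → d ≢ α → d ∉ₗ leaves Q →
  Σ[ ρ ∈ List A ] (Layout (node (node (node (leaf d) (leaf α)) Q) (leaf b)) (d ∷ α ∷ ρ) × Layout (node R₀ (leaf d)) (d ∷ α ∷ ρ))
cherry-first-layout {b = b} lP lR d≢b d≢α d∉Q with layout-starting-with-pendant lR lP
... | _ , lP′ , lR′ with Layout-node-first lP′ (λ { (here e) → d≢b e })
... | _ , _ , l₁ , lb , refl with Layout-node-first l₁ d∉Q
... | _ , ρQ , l₂ , _ , refl with Layout-node-first l₂ (λ { (here e) → d≢α e })
... | _ , _ , leaf , leaf , refl with lb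
... | leaf = ρQ ++ b ∷ [] , lP′ , lR′

-- Restriction to a set of matching edges

data Subtree {A : Set} (s : BT A) : BT A → Set where
  here : Subtree s s
  up   : ∀ {u d} → Subtree s u → Subtree s (node u d)
  down : ∀ {u d} → Subtree s d → Subtree s (node u d)

Subtree-∈ : {s t : BT A} {z : A} → Subtree s t → z ∈ₗ leaves s → z ∈ₗ leaves t
Subtree-∈ here m = m
Subtree-∈ (up p) m = ∈-++⁺ˡ (Subtree-∈ p m)
Subtree-∈ (down {u} p) m = ∈-++⁺ʳ (leaves u) (Subtree-∈ p m)

Subtree-unique : {s t : BT A} → Subtree s t → Unique (leaves t) → Unique (leaves s)
Subtree-unique here u = u
Subtree-unique (up p) u = Subtree-unique p (Unique-++⁻ˡ u)
Subtree-unique (down {a} p) u = Subtree-unique p (Unique-++⁻ʳ {xs = leaves a} u)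

Subtree-trans : {s t r : BT A} → Subtree s t → Subtree t r → Subtree s r
Subtree-trans p here = p
Subtree-trans p (up q) = up (Subtree-trans p q)
Subtree-trans p (down q) = down (Subtree-trans p q)

join : Maybe (BT A) → Maybe (BT A) → Maybe (BT A)
join (just u) (just d) = just (node u d)
join (just u) nothing = just u
join nothing r = r

join-nothingʳ : (m : Maybe (BT A)) → join m nothing ≡ m
join-nothingʳ (just x) = refl
join-nothingʳ nothing = refl

restrict-node : (E : Subset n) (u d : Tree n) → restrict E (node u d) ≡ join (restrict E u) (restrict E d)
restrict-node E u d with restrict E u | restrict E d
... | just _ | just _ = refl
... | just _ | nothing = refl
... | nothing | just _ = refl
... | nothing | nothing = refl

restrict-node-just : (E : Subset n) (u v : Tree n) {a b : Maybe (Tree n)} {t′ : Tree n} → restrict E (node u v) ≡ just t′ →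
  restrict E u ≡ a → restrict E v ≡ b → join a b ≡ just t′
restrict-node-just E u v e refl refl = trans (sym (restrict-node E u v)) e

leavesᴹ : Maybe (BT A) → List A
leavesᴹ nothing = []
leavesᴹ (just t) = leaves t

leavesᴹ-join : (a b : Maybe (BT A)) → leavesᴹ (join a b) ≡ leavesᴹ a ++ leavesᴹ b
leavesᴹ-join (just u) (just d) = refl
leavesᴹ-join (just u) nothing = sym (++-identityʳ (leaves u))
leavesᴹ-join nothing b = refl

keep : Subset n → List (Fin n) → List (Fin n)
keep E = filter (_∈? E)

leaves-restrict : (E : Subset n) (t : Tree n) → leavesᴹ (restrict E t) ≡ keep E (leaves t)
leaves-restrict E (leaf x) with x ∈? E
... | yes _ = refl
... | no _ = refl
leaves-restrict E (node u d) rewrite restrict-node E u d | leavesᴹ-join (restrict E u) (restrict E d)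
  | leaves-restrict E u | leaves-restrict E d = sym (filter-++ (_∈? E) (leaves u) (leaves d))

leaves-restrict-just : (E : Subset n) (t : Tree n) {t′ : Tree n} → restrict E t ≡ just t′ → leaves t′ ≡ keep E (leaves t)
leaves-restrict-just E t e = trans (cong leavesᴹ (sym e)) (leaves-restrict E t)

restrict-∈⁻ : (E : Subset n) (t t′ : Tree n) {z : Fin n} → restrict E t ≡ just t′ → z ∈ₗ leaves t′ → z ∈ₗ leaves t × z ∈ E
restrict-∈⁻ E t t′ e m = ∈-filter⁻ (_∈? E) {xs = leaves t} (subst (_ ∈ₗ_) (leaves-restrict-just E t e) m)

restrict-nothing⇒∉ : (E : Subset n) (t : Tree n) {z : Fin n} → restrict E t ≡ nothing → z ∈ₗ leaves t → z ∉ E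
restrict-nothing⇒∉ E t e m zE with subst (_ ∈ₗ_) (trans (sym (leaves-restrict E t)) (cong leavesᴹ e)) (∈-filter⁺ (_∈? E) m zE)
... | ()

restrict-just : (E : Subset n) (t : Tree n) {z : Fin n} → z ∈ₗ leaves t → z ∈ E → Σ[ t′ ∈ Tree n ] restrict E t ≡ just t′
restrict-just E t m zE with restrict E t in e
... | just t′ = t′ , refl
... | nothing = ⊥-elim (restrict-nothing⇒∉ E t e m zE)

restrict-leaf-∈ : (E : Subset n) (x : Fin n) → x ∈ E → restrict E (leaf x) ≡ just (leaf x)
restrict-leaf-∈ E x p with x ∈? E
... | yes _ = refl
... | no q = ⊥-elim (q p)

restrict-leaf-∉ : (E : Subset n) (x : Fin n) → x ∉ E → restrict E (leaf x) ≡ nothing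
restrict-leaf-∉ E x p with x ∈? E
... | yes q = ⊥-elim (p q)
... | no _ = refl

restrict-disjoint : (E : Subset n) (t : Tree n) → (∀ z → z ∈ₗ leaves t → z ∉ E) → restrict E t ≡ nothing
restrict-disjoint E (leaf x) h = restrict-leaf-∉ E x (h x (here refl))
restrict-disjoint E (node u d) h rewrite restrict-node E u d
  | restrict-disjoint E u (λ z m → h z (∈-++⁺ˡ m)) | restrict-disjoint E d (λ z m → h z (∈-++⁺ʳ (leaves u) m)) = refl

restrict-⊇ : (E : Subset n) (t : Tree n) → (∀ z → z ∈ₗ leaves t → z ∈ E) → restrict E t ≡ just t
restrict-⊇ E (leaf x) h = restrict-leaf-∈ E x (h x (here refl))
restrict-⊇ E (node u d) h rewrite restrict-node E u d
  | restrict-⊇ E u (λ z m → h z (∈-++⁺ˡ m)) | restrict-⊇ E d (λ z m → h z (∈-++⁺ʳ (leaves u) m)) = refl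

restrict-Subtree : (E : Subset n) {s t : Tree n} → Subtree s t → Unique (leaves t) →
  (∀ z → z ∈ₗ leaves t → z ∈ E → z ∈ₗ leaves s) → restrict E t ≡ restrict E s
restrict-Subtree E here u h = refl
restrict-Subtree E (up {a} {d} p) u h rewrite restrict-node E a d
  | restrict-disjoint E d (λ z mz zE → Unique-++-disjoint u (Subtree-∈ p (h z (∈-++⁺ʳ (leaves a) mz) zE)) mz)
  = trans (join-nothingʳ _) (restrict-Subtree E p (Unique-++⁻ˡ u) (λ z mz zE → h z (∈-++⁺ˡ mz) zE))
restrict-Subtree E (down {a} {d} p) u h rewrite restrict-node E a d
  | restrict-disjoint E a (λ z mz zE → Unique-++-disjoint u mz (Subtree-∈ p (h z (∈-++⁺ˡ mz) zE)))
  = restrict-Subtree E p (Unique-++⁻ʳ {xs = leaves a} u) (λ z mz zE → h z (∈-++⁺ʳ (leaves a) mz) zE)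

_⇝_ : Maybe (BT A) → BT A → Set
_⇝_ {A} m p = Σ[ t ∈ BT A ] (m ≡ just t × t ∼ p)

⇝-∼ : {m : Maybe (BT A)} {p q : BT A} → m ⇝ p → p ∼ q → m ⇝ q
⇝-∼ (t , e , r) s = t , e , ∼-trans r s

⇝-leaf : (E : Subset n) (x : Fin n) → x ∈ E → restrict E (leaf x) ⇝ leaf x
⇝-leaf E x p = leaf x , restrict-leaf-∈ E x p , leaf

⇝-leaf⁻ : {m : Maybe (BT A)} {x : A} → m ⇝ leaf x → m ≡ just (leaf x)
⇝-leaf⁻ (_ , e , leaf) = e

⇝-node : (E : Subset n) (u d : Tree n) {p q : Tree n} →
  restrict E u ⇝ p → restrict E d ⇝ q → restrict E (node u d) ⇝ node p q
⇝-node E u d (t₁ , e₁ , r₁) (t₂ , e₂ , r₂) rewrite restrict-node E u d | e₁ | e₂ = node t₁ t₂ , refl , node r₁ r₂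

⇝-node-swap : (E : Subset n) (u d : Tree n) {p q : Tree n} →
  restrict E u ⇝ p → restrict E d ⇝ q → restrict E (node u d) ⇝ node q p
⇝-node-swap E u d a b = ⇝-∼ (⇝-node E u d a b) (swap ∼-refl ∼-refl)

⇝-nodeˡ : (E : Subset n) (u d : Tree n) {p : Tree n} → restrict E u ⇝ p → restrict E d ≡ nothing → restrict E (node u d) ⇝ p
⇝-nodeˡ E u d (t₁ , e₁ , r₁) e₂ rewrite restrict-node E u d | e₁ | e₂ = t₁ , refl , r₁

⇝-nodeʳ : (E : Subset n) (u d : Tree n) {p : Tree n} → restrict E u ≡ nothing → restrict E d ⇝ p → restrict E (node u d) ⇝ p
⇝-nodeʳ E u d e₁ (t₂ , e₂ , r₂) rewrite restrict-node E u d | e₁ | e₂ = t₂ , refl , r₂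

record HitsOnly (E : Subset n) (t : Tree n) (zs : List (Fin n)) : Set where
  constructor hitsOnly
  field
    hits : ∀ {z} → z ∈ₗ leaves t → z ∈ E → z ∈ₗ zs
open HitsOnly

fromList-HitsOnly : (zs : List (Fin n)) {t : Tree n} → HitsOnly (fromList zs) t zs
fromList-HitsOnly zs = hitsOnly λ _ zE → fromList⁻ zs zE

module _ {E : Subset n} {zs : List (Fin n)} where

  HitsOnly-up : {u d : Tree n} → HitsOnly E (node u d) zs → HitsOnly E u zs
  HitsOnly-up h = hitsOnly λ m → hits h (∈-++⁺ˡ m)

  HitsOnly-down : {u d : Tree n} → HitsOnly E (node u d) zs → HitsOnly E d zs
  HitsOnly-down {u} h = hitsOnly λ m → hits h (∈-++⁺ʳ (leaves u) m)

  HitsOnly-narrow : {t : Tree n} {zs′ : List (Fin n)} → HitsOnly E t zs →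
    (∀ {z} → z ∈ₗ zs → z ∈ₗ leaves t → z ∈ₗ zs′) → HitsOnly E t zs′
  HitsOnly-narrow h f = hitsOnly λ m zE → f (hits h m zE) m

  HitsOnly-none : {t : Tree n} → HitsOnly E t zs → (∀ {z} → z ∈ₗ zs → z ∉ₗ leaves t) → restrict E t ≡ nothing
  HitsOnly-none {t} h f = restrict-disjoint E t λ z m zE → f (hits h m zE) m

restrict-single : (E : Subset n) (t : Tree n) (x : Fin n) → Unique (leaves t) → x ∈ₗ leaves t → x ∈ E →
  HitsOnly E t (x ∷ []) → restrict E t ⇝ leaf x
restrict-single E (leaf y) x u (here refl) xE h = ⇝-leaf E x xE
restrict-single E (node a b) x u m xE h with ∈-++⁻ (leaves a) m
... | inj₁ xa = ⇝-nodeˡ E a b (restrict-single E a x (Unique-++⁻ˡ u) xa xE (HitsOnly-up h))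
      (HitsOnly-none (HitsOnly-down h) λ { (here refl) → Unique-++-disjoint u xa })
... | inj₂ xb = ⇝-nodeʳ E a b (HitsOnly-none (HitsOnly-up h) λ { (here refl) xa → Unique-++-disjoint u xa xb })
      (restrict-single E b x (Unique-++⁻ʳ {xs = leaves a} u) xb xE (HitsOnly-down h))

restrict-cherry : (E : Subset n) (t : Tree n) (x y : Fin n) → Unique (leaves t) → x ≢ y → x ∈ₗ leaves t → y ∈ₗ leaves t →
  x ∈ E → y ∈ E → HitsOnly E t (x ∷ y ∷ []) → restrict E t ⇝ node (leaf x) (leaf y)
restrict-cherry E (leaf z) x y u x≢y (here refl) (here refl) xE yE h = ⊥-elim (x≢y refl)
restrict-cherry E (node a b) x y u x≢y mx my xE yE h with ∈-++⁻ (leaves a) mx | ∈-++⁻ (leaves a) my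
... | inj₁ xa | inj₁ ya = ⇝-nodeˡ E a b (restrict-cherry E a x y (Unique-++⁻ˡ u) x≢y xa ya xE yE (HitsOnly-up h))
      (HitsOnly-none (HitsOnly-down h) λ { (here refl) → Unique-++-disjoint u xa ; (there (here refl)) → Unique-++-disjoint u ya })
... | inj₂ xb | inj₂ yb = ⇝-nodeʳ E a b
      (HitsOnly-none (HitsOnly-up h) λ { (here refl) xa → Unique-++-disjoint u xa xb ; (there (here refl)) ya → Unique-++-disjoint u ya yb })
      (restrict-cherry E b x y (Unique-++⁻ʳ {xs = leaves a} u) x≢y xb yb xE yE (HitsOnly-down h))
... | inj₁ xa | inj₂ yb = ⇝-node E a b
      (restrict-single E a x (Unique-++⁻ˡ u) xa xE (HitsOnly-narrow (HitsOnly-up h)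
        λ { (here refl) _ → here refl ; (there (here refl)) ya → ⊥-elim (Unique-++-disjoint u ya yb) }))
      (restrict-single E b y (Unique-++⁻ʳ {xs = leaves a} u) yb yE (HitsOnly-narrow (HitsOnly-down h)
        λ { (here refl) xb → ⊥-elim (Unique-++-disjoint u xa xb) ; (there (here refl)) _ → here refl }))
... | inj₂ xb | inj₁ ya = ⇝-node-swap E a b
      (restrict-single E a y (Unique-++⁻ˡ u) ya yE (HitsOnly-narrow (HitsOnly-up h)
        λ { (here refl) xa → ⊥-elim (Unique-++-disjoint u xa xb) ; (there (here refl)) _ → here refl }))
      (restrict-single E b x (Unique-++⁻ʳ {xs = leaves a} u) xb xE (HitsOnly-narrow (HitsOnly-down h)
        λ { (here refl) _ → here refl ; (there (here refl)) yb → ⊥-elim (Unique-++-disjoint u ya yb) }))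

restrict-caterpillar : (E : Subset n) {s t : Tree n} (x b y : Fin n) → Subtree s t → Unique (leaves t) → x ≢ b →
  x ∈ₗ leaves s → b ∈ₗ leaves s → y ∈ₗ leaves t → y ∉ₗ leaves s → x ∈ E → b ∈ E → y ∈ E →
  HitsOnly E t (x ∷ b ∷ y ∷ []) → restrict E t ⇝ node (node (leaf x) (leaf b)) (leaf y)
restrict-caterpillar E x b y here u x≢b xs bs yt y∉s xE bE yE h = ⊥-elim (y∉s yt)
restrict-caterpillar E x b y (up {a} {d} p) u x≢b xs bs yt y∉s xE bE yE h with ∈-++⁻ (leaves a) yt
... | inj₁ ya = ⇝-nodeˡ E a d (restrict-caterpillar E x b y p (Unique-++⁻ˡ u) x≢b xs bs ya y∉s xE bE yE (HitsOnly-up h))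
      (HitsOnly-none (HitsOnly-down h) λ { (here refl) → Unique-++-disjoint u (Subtree-∈ p xs)
                                          ; (there (here refl)) → Unique-++-disjoint u (Subtree-∈ p bs)
                                          ; (there (there (here refl))) → Unique-++-disjoint u ya })
... | inj₂ yd = ⇝-node E a d
      (restrict-cherry E a x b (Unique-++⁻ˡ u) x≢b (Subtree-∈ p xs) (Subtree-∈ p bs) xE bE (HitsOnly-narrow (HitsOnly-up h)
        λ { (here refl) _ → here refl ; (there (here refl)) _ → there (here refl)
          ; (there (there (here refl))) ya → ⊥-elim (Unique-++-disjoint u ya yd) }))
      (restrict-single E d y (Unique-++⁻ʳ {xs = leaves a} u) yd yE (HitsOnly-narrow (HitsOnly-down h)
        λ { (here refl) xd → ⊥-elim (Unique-++-disjoint u (Subtree-∈ p xs) xd)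
          ; (there (here refl)) bd → ⊥-elim (Unique-++-disjoint u (Subtree-∈ p bs) bd)
          ; (there (there (here refl))) _ → here refl }))
restrict-caterpillar E x b y (down {a} {d} p) u x≢b xs bs yt y∉s xE bE yE h with ∈-++⁻ (leaves a) yt
... | inj₂ yd = ⇝-nodeʳ E a d
      (HitsOnly-none (HitsOnly-up h) λ { (here refl) xa → Unique-++-disjoint u xa (Subtree-∈ p xs)
                                         ; (there (here refl)) ba → Unique-++-disjoint u ba (Subtree-∈ p bs)
                                         ; (there (there (here refl))) ya → Unique-++-disjoint u ya yd })
      (restrict-caterpillar E x b y p (Unique-++⁻ʳ {xs = leaves a} u) x≢b xs bs yd y∉s xE bE yE (HitsOnly-down h))
... | inj₁ ya = ⇝-node-swap E a d
      (restrict-single E a y (Unique-++⁻ˡ u) ya yE (HitsOnly-narrow (HitsOnly-up h)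
        λ { (here refl) xa → ⊥-elim (Unique-++-disjoint u xa (Subtree-∈ p xs))
          ; (there (here refl)) ba → ⊥-elim (Unique-++-disjoint u ba (Subtree-∈ p bs))
          ; (there (there (here refl))) _ → here refl }))
      (restrict-cherry E d x b (Unique-++⁻ʳ {xs = leaves a} u) x≢b (Subtree-∈ p xs) (Subtree-∈ p bs) xE bE (HitsOnly-narrow (HitsOnly-down h)
        λ { (here refl) _ → here refl ; (there (here refl)) _ → there (here refl)
          ; (there (there (here refl))) yd → ⊥-elim (Unique-++-disjoint u ya yd) }))

data _≈ᴹ_ {A : Set} : Maybe (BT A) → Maybe (BT A) → Set where
  nothing : nothing ≈ᴹ nothing
  just : ∀ {a b} → a ∼ b → just a ≈ᴹ just b

≈ᴹ-trans : {a b c : Maybe (BT A)} → a ≈ᴹ b → b ≈ᴹ c → a ≈ᴹ c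
≈ᴹ-trans nothing nothing = nothing
≈ᴹ-trans (just p) (just q) = just (∼-trans p q)

join-resp-≈ᴹ : {a a′ b b′ : Maybe (BT A)} → a ≈ᴹ a′ → b ≈ᴹ b′ → join a b ≈ᴹ join a′ b′
join-resp-≈ᴹ nothing q = q
join-resp-≈ᴹ (just p) nothing = just p
join-resp-≈ᴹ (just p) (just q) = just (node p q)

join-comm : (a b : Maybe (BT A)) → join a b ≈ᴹ join b a
join-comm (just x) (just y) = just (swap ∼-refl ∼-refl)
join-comm (just x) nothing = just ∼-refl
join-comm nothing (just y) = just ∼-refl
join-comm nothing nothing = nothing

restrict-∼ : (E : Subset n) {t s : Tree n} → t ∼ s → restrict E t ≈ᴹ restrict E s
restrict-∼ E {leaf x} leaf with x ∈? E
... | yes _ = just leaf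
... | no _ = nothing
restrict-∼ E (node {a} {b} {c} {d} p q) rewrite restrict-node E a b | restrict-node E c d =
  join-resp-≈ᴹ (restrict-∼ E p) (restrict-∼ E q)
restrict-∼ E (swap {a} {b} {c} {d} p q) rewrite restrict-node E a b | restrict-node E c d =
  ≈ᴹ-trans (join-resp-≈ᴹ (restrict-∼ E p) (restrict-∼ E q)) (join-comm (restrict E d) (restrict E c))

≈ᴹ-just⇒⇝ : {a : Maybe (BT A)} {t : BT A} → a ≈ᴹ just t → a ⇝ t
≈ᴹ-just⇒⇝ (just p) = _ , refl , p

⇝-resp-∼ : (E : Subset n) {t s p : Tree n} → t ∼ s → restrict E s ⇝ p → restrict E t ⇝ p
⇝-resp-∼ E {t} q (_ , e , r) = ⇝-∼ (≈ᴹ-just⇒⇝ (subst (restrict E t ≈ᴹ_) e (restrict-∼ E q))) r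

restrict-restrict : (E E₀ : Subset n) (t t′ : Tree n) → restrict E t ≡ just t′ →
  (∀ z → z ∈ₗ leaves t → z ∈ E₀ → z ∈ E) → restrict E₀ t′ ≡ restrict E₀ t
restrict-restrict E E₀ (leaf x) t′ e h with x ∈? E
restrict-restrict E E₀ (leaf x) .(leaf x) refl h | yes _ = refl
restrict-restrict E E₀ (leaf x) t′ () h | no _
restrict-restrict E E₀ (node u d) t′ e h with restrict E u in eu | restrict E d in ed | trans (sym (restrict-node E u d)) e
... | just u′ | just d′ | refl rewrite restrict-node E₀ u′ d′ | restrict-node E₀ u d =
  cong₂ join (restrict-restrict E E₀ u u′ eu λ z m → h z (∈-++⁺ˡ m)) (restrict-restrict E E₀ d d′ ed λ z m → h z (∈-++⁺ʳ (leaves u) m))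
... | just u′ | nothing | refl rewrite restrict-node E₀ u d
  | restrict-disjoint E₀ d (λ z m zE₀ → restrict-nothing⇒∉ E d ed m (h z (∈-++⁺ʳ (leaves u) m) zE₀)) =
  trans (restrict-restrict E E₀ u u′ eu λ z m → h z (∈-++⁺ˡ m)) (sym (join-nothingʳ _))
... | nothing | just d′ | refl rewrite restrict-node E₀ u d
  | restrict-disjoint E₀ u (λ z m zE₀ → restrict-nothing⇒∉ E u eu m (h z (∈-++⁺ˡ m) zE₀)) =
  restrict-restrict E E₀ d d′ ed λ z m → h z (∈-++⁺ʳ (leaves u) m)
... | nothing | nothing | ()

keep-none : (E : Subset n) (σ : List (Fin n)) → (∀ z → z ∈ₗ σ → z ∉ E) → keep E σ ≡ []
keep-none E σ h = filter-none (_∈? E) (All.tabulate (λ {z} → h z))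

keep-∉∷∈∷ : (E : Subset n) (d α : Fin n) (ρ : List (Fin n)) → d ∉ E → α ∈ E → keep E (d ∷ α ∷ ρ) ≡ α ∷ keep E ρ
keep-∉∷∈∷ E d α ρ dE αE with d ∈? E
... | yes d∈E = ⊥-elim (dE d∈E)
... | no _ with α ∈? E
...   | yes _ = refl
...   | no α∉E = ⊥-elim (α∉E αE)

Layout-restrict : (E : Subset n) {t t′ : Tree n} {σ : List (Fin n)} → Layout t σ → restrict E t ≡ just t′ → Layout t′ (keep E σ)
Layout-restrict E (leaf {x}) e with x ∈? E
Layout-restrict E (leaf {x}) refl | yes _ = leaf
Layout-restrict E (leaf {x}) () | no _
Layout-restrict E (node {u} {d} {σ} {τ} l₁ l₂) e with restrict E u in eu | restrict E d in ed | trans (sym (restrict-node E u d)) e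
... | just _ | just _ | refl = subst (Layout _) (sym (filter-++ (_∈? E) σ τ)) (node (Layout-restrict E l₁ eu) (Layout-restrict E l₂ ed))
... | just _ | nothing | refl = subst (Layout _) (sym (trans (filter-++ (_∈? E) σ τ)
      (trans (cong (keep E σ ++_) (keep-none E τ λ z m → restrict-nothing⇒∉ E d ed (Layout-∈ l₂ m))) (++-identityʳ _))))
      (Layout-restrict E l₁ eu)
... | nothing | just _ | refl = subst (Layout _) (sym (trans (filter-++ (_∈? E) σ τ)
      (cong (_++ keep E τ) (keep-none E σ λ z m → restrict-nothing⇒∉ E u eu (Layout-∈ l₁ m)))))
      (Layout-restrict E l₂ ed)
... | nothing | nothing | ()
Layout-restrict E (swap {u} {d} {σ} {τ} l₁ l₂) e with restrict E u in eu | restrict E d in ed | trans (sym (restrict-node E u d)) e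
... | just _ | just _ | refl = subst (Layout _) (sym (filter-++ (_∈? E) τ σ)) (swap (Layout-restrict E l₁ eu) (Layout-restrict E l₂ ed))
... | just _ | nothing | refl = subst (Layout _) (sym (trans (filter-++ (_∈? E) τ σ)
      (cong (_++ keep E σ) (keep-none E τ λ z m → restrict-nothing⇒∉ E d ed (Layout-∈ l₂ m)))))
      (Layout-restrict E l₁ eu)
... | nothing | just _ | refl = subst (Layout _) (sym (trans (filter-++ (_∈? E) τ σ)
      (trans (cong (keep E τ ++_) (keep-none E σ λ z m → restrict-nothing⇒∉ E u eu (Layout-∈ l₁ m))) (++-identityʳ _))))
      (Layout-restrict E l₂ ed)
... | nothing | nothing | ()

-- Induced copies of T₁ and T₂

leaves-map : {B : Set} (f : A → B) (t : BT A) → leaves (map f t) ≡ lmap f (leaves t)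
leaves-map f (leaf x) = refl
leaves-map f (node u d) rewrite leaves-map f u | leaves-map f d = sym (map-++ f (leaves u) (leaves d))

map-∘ : {B C : Set} (f : B → C) (g : A → B) (t : BT A) → map f (map g t) ≡ map (f ∘ g) t
map-∘ f g (leaf x) = refl
map-∘ f g (node u d) = cong₂ node (map-∘ f g u) (map-∘ f g d)

leaves-map-∈ : {B : Set} (f : A → B) (t : BT A) {x : A} → x ∈ₗ leaves t → f x ∈ₗ leaves (map f t)
leaves-map-∈ f t m = subst (_ ∈ₗ_) (sym (leaves-map f t)) (∈-map⁺ f m)

L-∋ : {k : ℕ} (T : Tanglegram k) (j : Fin k) → j ∈ₗ leaves (L T)
L-∋ T j = ∈-resp-↭ (↭-sym (L-ok T)) (∈-allFin j)

R-∋ : {k : ℕ} (T : Tanglegram k) (j : Fin k) → j ∈ₗ leaves (R T)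
R-∋ T j = ∈-resp-↭ (↭-sym (R-ok T)) (∈-allFin j)

Induces : {k : ℕ} → Tanglegram k → Tree n → Tree n → Set
Induces {n} {k} T′ L′ R′ =
  Σ[ E ∈ Subset n ] Σ[ f ∈ (Fin k → Fin n) ]
    Injective _≡_ _≡_ f ×
    (∀ j → f j ∈ E) × (∀ i → i ∈ E → ∃[ j ] f j ≡ i) ×
    (Σ[ L₀ ∈ BT (Fin n) ] restrict E L′ ≡ just L₀ × map f (L T′) ∼ L₀) ×
    (Σ[ R₀ ∈ BT (Fin n) ] restrict E R′ ≡ just R₀ × map f (R T′) ∼ R₀)

Induces-resp-∼ : {k : ℕ} (T′ : Tanglegram k) {L₁ L₂ R₁ R₂ : Tree n} → L₁ ∼ L₂ → R₁ ∼ R₂ → Induces T′ L₂ R₂ → Induces T′ L₁ R₁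
Induces-resp-∼ T′ pL pR (E , f , inj , f∈E , onto , (L₀ , eL , sL) , (R₀ , eR , sR))
  with ⇝-resp-∼ E pL (L₀ , eL , ∼-sym sL) | ⇝-resp-∼ E pR (R₀ , eR , ∼-sym sR)
... | L₁ , eL₁ , tL | R₁ , eR₁ , tR = E , f , inj , f∈E , onto , (L₁ , eL₁ , ∼-sym tL) , (R₁ , eR₁ , ∼-sym tR)

Induces-unrestrict : {k : ℕ} (T′ : Tanglegram k) (E : Subset n) {L₁ R₁ L′ R′ : Tree n} →
  restrict E L₁ ≡ just L′ → restrict E R₁ ≡ just R′ → Induces T′ L′ R′ → Induces T′ L₁ R₁
Induces-unrestrict {n} {k} T′ E {L₁} {R₁} {L′} {R′} eL eR (E₀ , f , inj , f∈E₀ , onto , (L₀ , eL₀ , sL) , (R₀ , eR₀ , sR)) =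
  E₀ , f , inj , f∈E₀ , onto , (L₀ , trans (sym (restrict-restrict E E₀ L₁ L′ eL (E₀⊆E L₁ eL eL₀ sL (L-∋ T′)))) eL₀ , sL)
                             , (R₀ , trans (sym (restrict-restrict E E₀ R₁ R′ eR (E₀⊆E R₁ eR eR₀ sR (R-∋ T′)))) eR₀ , sR)
  where
  E₀⊆E : (t : Tree n) {t′ t₀ : Tree n} {T₀ : BT (Fin k)} → restrict E t ≡ just t′ → restrict E₀ t′ ≡ just t₀ → map f T₀ ∼ t₀ →
    (∀ j → j ∈ₗ leaves T₀) → ∀ z → z ∈ₗ leaves t → z ∈ E₀ → z ∈ E
  E₀⊆E t {t′} {t₀} {T₀} e e₀ s T₀∋ z _ zE₀ with onto z zE₀
  ... | j , refl = proj₂ (restrict-∈⁻ E t t′ e (proj₁ (restrict-∈⁻ E₀ t′ t₀ e₀ (∼-∈ s (leaves-map-∈ f T₀ (T₀∋ j))))))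

Obstructed : Tree n → Tree n → Set
Obstructed L′ R′ = Induces T₁ L′ R′ ⊎ Induces T₂ L′ R′

Obstructed-resp-∼ : {L₁ L₂ R₁ R₂ : Tree n} → L₁ ∼ L₂ → R₁ ∼ R₂ → Obstructed L₂ R₂ → Obstructed L₁ R₁
Obstructed-resp-∼ pL pR = Sum.map (Induces-resp-∼ T₁ pL pR) (Induces-resp-∼ T₂ pL pR)

Obstructed-unrestrict : (E : Subset n) {L₁ R₁ L′ R′ : Tree n} → restrict E L₁ ≡ just L′ → restrict E R₁ ≡ just R′ →
  Obstructed L′ R′ → Obstructed L₁ R₁
Obstructed-unrestrict E {L₁} {R₁} {L′} {R′} eL eR =
  Sum.map (Induces-unrestrict T₁ E {L₁} {R₁} {L′} {R′} eL eR) (Induces-unrestrict T₂ E {L₁} {R₁} {L′} {R′} eL eR)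

-- T₁ and T₂ are isomorphic to their mirror images (left and right trees interchanged) via these relabellings.
T₁-mirror : Fin 4 → Fin 4
T₁-mirror zero = zero
T₁-mirror (suc zero) = suc (suc (suc zero))
T₁-mirror (suc (suc zero)) = suc (suc zero)
T₁-mirror (suc (suc (suc zero))) = suc zero

T₂-mirror : Fin 4 → Fin 4
T₂-mirror zero = zero
T₂-mirror (suc zero) = suc (suc zero)
T₂-mirror (suc (suc zero)) = suc zero
T₂-mirror (suc (suc (suc zero))) = suc (suc (suc zero))

T₁-mirror-involutive : ∀ j → T₁-mirror (T₁-mirror j) ≡ j
T₁-mirror-involutive zero = refl
T₁-mirror-involutive (suc zero) = refl
T₁-mirror-involutive (suc (suc zero)) = refl
T₁-mirror-involutive (suc (suc (suc zero))) = refl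

T₂-mirror-involutive : ∀ j → T₂-mirror (T₂-mirror j) ≡ j
T₂-mirror-involutive zero = refl
T₂-mirror-involutive (suc zero) = refl
T₂-mirror-involutive (suc (suc zero)) = refl
T₂-mirror-involutive (suc (suc (suc zero))) = refl

Induces-mirror : {k : ℕ} (T′ T″ : Tanglegram k) (g : Fin k → Fin k) → (∀ j → g (g j) ≡ j) →
  map g (L T′) ≡ R T″ → map g (R T′) ≡ L T″ → {L′ R′ : Tree n} → Induces T″ L′ R′ → Induces T′ R′ L′
Induces-mirror T′ T″ g g-inv eL eR (E , f , inj , f∈E , onto , (L₀ , eL₀ , sL) , (R₀ , eR₀ , sR)) =
  E , f ∘ g , g-injective ∘ inj , f∈E ∘ g , g-onto , (R₀ , eR₀ , twist eL sR) , (L₀ , eL₀ , twist eR sL)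
  where
  g-injective : Injective _≡_ _≡_ g
  g-injective {i} {j} e = trans (sym (g-inv i)) (trans (cong g e) (g-inv j))
  g-onto : ∀ i → i ∈ E → ∃[ j ] f (g j) ≡ i
  g-onto i m with onto i m
  ... | j , e = g j , trans (cong f (g-inv j)) e
  twist : {t t′ : BT (Fin _)} {t₀ : Tree _} → map g t ≡ t′ → map f t′ ∼ t₀ → map (f ∘ g) t ∼ t₀
  twist {t} refl s = subst (_∼ _) (map-∘ f g t) s

Obstructed-swap : {L′ R′ : Tree n} → Obstructed L′ R′ → Obstructed R′ L′
Obstructed-swap {L′ = L′} {R′} = Sum.map (Induces-mirror T₁ T₁ T₁-mirror T₁-mirror-involutive refl refl {L′} {R′})
                                         (Induces-mirror T₂ T₂ T₂-mirror T₂-mirror-involutive refl refl {L′} {R′})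

quad : Fin n → Fin n → Fin n → Fin n → Fin 4 → Fin n
quad a b c d zero = a
quad a b c d (suc zero) = b
quad a b c d (suc (suc zero)) = c
quad a b c d (suc (suc (suc zero))) = d

record Distinct4 {n : ℕ} (a b c d : Fin n) : Set where
  field
    a≢b : a ≢ b
    a≢c : a ≢ c
    a≢d : a ≢ d
    b≢c : b ≢ c
    b≢d : b ≢ d
    c≢d : c ≢ d
open Distinct4

quad-injective : {a b c d : Fin n} → Distinct4 a b c d → Injective _≡_ _≡_ (quad a b c d)
quad-injective D {zero} {zero} e = refl
quad-injective D {zero} {suc zero} e = ⊥-elim (a≢b D e)
quad-injective D {zero} {suc (suc zero)} e = ⊥-elim (a≢c D e)
quad-injective D {zero} {suc (suc (suc zero))} e = ⊥-elim (a≢d D e)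
quad-injective D {suc zero} {zero} e = ⊥-elim (a≢b D (sym e))
quad-injective D {suc zero} {suc zero} e = refl
quad-injective D {suc zero} {suc (suc zero)} e = ⊥-elim (b≢c D e)
quad-injective D {suc zero} {suc (suc (suc zero))} e = ⊥-elim (b≢d D e)
quad-injective D {suc (suc zero)} {zero} e = ⊥-elim (a≢c D (sym e))
quad-injective D {suc (suc zero)} {suc zero} e = ⊥-elim (b≢c D (sym e))
quad-injective D {suc (suc zero)} {suc (suc zero)} e = refl
quad-injective D {suc (suc zero)} {suc (suc (suc zero))} e = ⊥-elim (c≢d D e)
quad-injective D {suc (suc (suc zero))} {zero} e = ⊥-elim (a≢d D (sym e))
quad-injective D {suc (suc (suc zero))} {suc zero} e = ⊥-elim (b≢d D (sym e))
quad-injective D {suc (suc (suc zero))} {suc (suc zero)} e = ⊥-elim (c≢d D (sym e))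
quad-injective D {suc (suc (suc zero))} {suc (suc (suc zero))} e = refl

quadSet : Fin n → Fin n → Fin n → Fin n → Subset n
quadSet a b c d = fromList (a ∷ b ∷ c ∷ d ∷ [])

quad-∈ : (a b c d : Fin n) → ∀ j → quad a b c d j ∈ quadSet a b c d
quad-∈ a b c d zero = fromList⁺ (a ∷ b ∷ c ∷ d ∷ []) (here refl)
quad-∈ a b c d (suc zero) = fromList⁺ (a ∷ b ∷ c ∷ d ∷ []) (there (here refl))
quad-∈ a b c d (suc (suc zero)) = fromList⁺ (a ∷ b ∷ c ∷ d ∷ []) (there (there (here refl)))
quad-∈ a b c d (suc (suc (suc zero))) = fromList⁺ (a ∷ b ∷ c ∷ d ∷ []) (there (there (there (here refl))))

quad-onto : (a b c d : Fin n) → ∀ i → i ∈ quadSet a b c d → ∃[ j ] quad a b c d j ≡ i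
quad-onto a b c d i m with fromList⁻ (a ∷ b ∷ c ∷ d ∷ []) m
... | here e = zero , sym e
... | there (here e) = suc zero , sym e
... | there (there (here e)) = suc (suc zero) , sym e
... | there (there (there (here e))) = suc (suc (suc zero)) , sym e

induces-from : (T′ : Tanglegram 4) {L′ R′ : Tree n} (a b c d : Fin n) → Distinct4 a b c d →
  restrict (quadSet a b c d) L′ ⇝ map (quad a b c d) (L T′) →
  restrict (quadSet a b c d) R′ ⇝ map (quad a b c d) (R T′) → Induces T′ L′ R′
induces-from T′ a b c d D (L₀ , eL , sL) (R₀ , eR , sR) =
  quadSet a b c d , quad a b c d , quad-injective D , quad-∈ a b c d , quad-onto a b c d ,
  (L₀ , eL , ∼-sym sL) , (R₀ , eR , ∼-sym sR)

restrict-two-cherries : (E : Subset n) (P Q : Tree n) (a b c d : Fin n) → Unique (leaves (node P Q)) →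
  a ∈ₗ leaves P → b ∈ₗ leaves P → c ∈ₗ leaves Q → d ∈ₗ leaves Q → a ≢ b → c ≢ d → a ∈ E → b ∈ E → c ∈ E → d ∈ E →
  HitsOnly E (node P Q) (a ∷ b ∷ c ∷ d ∷ []) → restrict E (node P Q) ⇝ node (node (leaf a) (leaf b)) (node (leaf c) (leaf d))
restrict-two-cherries E P Q a b c d u aP bP cQ dQ a≢b c≢d aE bE cE dE h = ⇝-node E P Q
  (restrict-cherry E P a b (Unique-++⁻ˡ u) a≢b aP bP aE bE (HitsOnly-narrow (HitsOnly-up h)
    λ { (here refl) _ → here refl ; (there (here refl)) _ → there (here refl)
      ; (there (there (here refl))) cP → ⊥-elim (Unique-++-disjoint u cP cQ)
      ; (there (there (there (here refl)))) dP → ⊥-elim (Unique-++-disjoint u dP dQ) }))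
  (restrict-cherry E Q c d (Unique-++⁻ʳ {xs = leaves P} u) c≢d cQ dQ cE dE (HitsOnly-narrow (HitsOnly-down h)
    λ { (here refl) aQ → ⊥-elim (Unique-++-disjoint u aP aQ) ; (there (here refl)) bQ → ⊥-elim (Unique-++-disjoint u bP bQ)
      ; (there (there (here refl))) _ → here refl ; (there (there (there (here refl)))) _ → there (here refl) }))

induces-T₂ : {L′ R′ : Tree n} (P Q r₁ r₂ : Tree n) → Subtree (node P Q) L′ → Subtree (node r₁ r₂) R′ →
  Unique (leaves L′) → Unique (leaves R′) → (x₁ x₂ y₁ y₂ : Fin n) →
  x₁ ∈ₗ leaves P → x₂ ∈ₗ leaves P → y₁ ∈ₗ leaves Q → y₂ ∈ₗ leaves Q →
  x₁ ∈ₗ leaves r₁ → y₁ ∈ₗ leaves r₁ → x₂ ∈ₗ leaves r₂ → y₂ ∈ₗ leaves r₂ → Induces T₂ L′ R′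
induces-T₂ {L′ = L′} {R′} P Q r₁ r₂ sL sR uL uR x₁ x₂ y₁ y₂ x₁P x₂P y₁Q y₂Q x₁r y₁r x₂r y₂r =
  induces-from T₂ {L′} {R′} x₁ x₂ y₁ y₂ distinct
    (subst (_⇝ _) (sym (restrict-Subtree E sL uL λ _ _ zE → PQ∋ (fromList⁻ qs zE)))
      (restrict-two-cherries E P Q x₁ x₂ y₁ y₂ uPQ x₁P x₂P y₁Q y₂Q (a≢b distinct) (c≢d distinct) x₁∈E x₂∈E y₁∈E y₂∈E
        (fromList-HitsOnly qs)))
    (subst (_⇝ _) (sym (restrict-Subtree E sR uR λ _ _ zE → r∋ (fromList⁻ qs zE)))
      (restrict-two-cherries E r₁ r₂ x₁ y₁ x₂ y₂ ur x₁r y₁r x₂r y₂r (a≢c distinct) (b≢d distinct) x₁∈E y₁∈E x₂∈E y₂∈E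
        (HitsOnly-narrow (fromList-HitsOnly qs) λ { (here refl) _ → here refl ; (there (here refl)) _ → there (there (here refl))
          ; (there (there (here refl))) _ → there (here refl) ; (there (there (there (here refl)))) _ → there (there (there (here refl))) })))
  where
  qs : List (Fin _)
  qs = x₁ ∷ x₂ ∷ y₁ ∷ y₂ ∷ []
  E : Subset _
  E = fromList qs
  x₁∈E : x₁ ∈ E
  x₁∈E = fromList⁺ qs (here refl)
  x₂∈E : x₂ ∈ E
  x₂∈E = fromList⁺ qs (there (here refl))
  y₁∈E : y₁ ∈ E
  y₁∈E = fromList⁺ qs (there (there (here refl)))
  y₂∈E : y₂ ∈ E
  y₂∈E = fromList⁺ qs (there (there (there (here refl))))
  uPQ : Unique (leaves (node P Q))
  uPQ = Subtree-unique sL uL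
  ur : Unique (leaves (node r₁ r₂))
  ur = Subtree-unique sR uR
  distinct : Distinct4 x₁ x₂ y₁ y₂
  distinct = record { a≢b = Unique-++-≢ ur x₁r x₂r ; a≢c = Unique-++-≢ uPQ x₁P y₁Q ; a≢d = Unique-++-≢ uPQ x₁P y₂Q
                    ; b≢c = Unique-++-≢ uPQ x₂P y₁Q ; b≢d = Unique-++-≢ uPQ x₂P y₂Q ; c≢d = Unique-++-≢ ur y₁r y₂r }
  PQ∋ : ∀ {z} → z ∈ₗ qs → z ∈ₗ leaves (node P Q)
  PQ∋ (here refl) = ∈-++⁺ˡ x₁P
  PQ∋ (there (here refl)) = ∈-++⁺ˡ x₂P
  PQ∋ (there (there (here refl))) = ∈-++⁺ʳ (leaves P) y₁Q
  PQ∋ (there (there (there (here refl)))) = ∈-++⁺ʳ (leaves P) y₂Q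
  r∋ : ∀ {z} → z ∈ₗ qs → z ∈ₗ leaves (node r₁ r₂)
  r∋ (here refl) = ∈-++⁺ˡ x₁r
  r∋ (there (here refl)) = ∈-++⁺ʳ (leaves r₁) x₂r
  r∋ (there (there (here refl))) = ∈-++⁺ˡ y₁r
  r∋ (there (there (there (here refl)))) = ∈-++⁺ʳ (leaves r₁) y₂r

induces-T₁ : (P Q R₁ s : Tree n) (b d x y : Fin n) → Unique (leaves (node (node P Q) (leaf b))) →
  Unique (leaves (node R₁ (leaf d))) → Subtree s R₁ → d ∈ₗ leaves P → x ∈ₗ leaves P → y ∈ₗ leaves Q →
  x ∈ₗ leaves s → b ∈ₗ leaves s → y ∈ₗ leaves R₁ → y ∉ₗ leaves s → d ≢ x →
  Induces T₁ (node (node P Q) (leaf b)) (node R₁ (leaf d))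
induces-T₁ P Q R₁ s b d x y uL uR ss dP xP yQ xs bs yR y∉s d≢x =
  induces-from T₁ {node (node P Q) (leaf b)} {node R₁ (leaf d)} x d y b distinct
    (⇝-∼ (⇝-node E (node P Q) (leaf b)
            (⇝-node E P Q
              (restrict-cherry E P d x (Unique-++⁻ˡ uPQ) d≢x dP xP (∈E (there (here refl))) (∈E (here refl))
                (HitsOnly-narrow (fromList-HitsOnly qs) λ { (here refl) _ → there (here refl) ; (there (here refl)) _ → here refl
                   ; (there (there (here refl))) yP → ⊥-elim (Unique-++-disjoint uPQ yP yQ)
                   ; (there (there (there (here refl)))) bP → ⊥-elim (Unique-++-disjoint uL (∈-++⁺ˡ bP) (here refl)) }))
              (restrict-single E Q y (Unique-++⁻ʳ {xs = leaves P} uPQ) yQ (∈E (there (there (here refl))))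
                (HitsOnly-narrow (fromList-HitsOnly qs) λ { (here refl) xQ → ⊥-elim (Unique-++-disjoint uPQ xP xQ)
                   ; (there (here refl)) dQ → ⊥-elim (Unique-++-disjoint uPQ dP dQ)
                   ; (there (there (here refl))) _ → here refl
                   ; (there (there (there (here refl)))) bQ → ⊥-elim (Unique-++-disjoint uL (∈-++⁺ʳ (leaves P) bQ) (here refl)) })))
            (⇝-leaf E b (∈E (there (there (there (here refl)))))))
         (node (node (swap leaf leaf) leaf) leaf))
    (⇝-node E R₁ (leaf d)
      (restrict-caterpillar E x b y ss (Unique-++⁻ˡ uR) (≢-sym b≢x) xs bs yR y∉s (∈E (here refl)) (∈E (there (there (there (here refl)))))
        (∈E (there (there (here refl))))
        (HitsOnly-narrow (fromList-HitsOnly qs) λ { (here refl) _ → here refl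
           ; (there (here refl)) dR₁ → ⊥-elim (Unique-++-disjoint uR dR₁ (here refl))
           ; (there (there (here refl))) _ → there (there (here refl)) ; (there (there (there (here refl)))) _ → there (here refl) }))
      (⇝-leaf E d (∈E (there (here refl)))))
  where
  qs : List (Fin _)
  qs = x ∷ d ∷ y ∷ b ∷ []
  E : Subset _
  E = fromList qs
  ∈E : ∀ {z} → z ∈ₗ qs → z ∈ E
  ∈E = fromList⁺ qs
  uPQ : Unique (leaves (node P Q))
  uPQ = Unique-++⁻ˡ uL
  b∉PQ : ∀ {z} → z ∈ₗ leaves (node P Q) → b ≢ z
  b∉PQ m refl = Unique-++-disjoint uL m (here refl)
  b≢x : b ≢ x
  b≢x = b∉PQ (∈-++⁺ˡ xP)
  distinct : Distinct4 x d y b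
  distinct = record { a≢b = ≢-sym d≢x ; a≢c = Unique-++-≢ uPQ xP yQ ; a≢d = ≢-sym b≢x
                    ; b≢c = Unique-++-≢ uPQ dP yQ ; b≢d = ≢-sym (b∉PQ (∈-++⁺ˡ dP)) ; c≢d = ≢-sym (b∉PQ (∈-++⁺ʳ (leaves P) yQ)) }

-- Gluing layouts across a separating vertex

LeavesIn : Subset n → Tree n → Set
LeavesIn X t = ∀ z → z ∈ₗ leaves t → z ∈ X

LeavesOut : Subset n → Tree n → Set
LeavesOut X t = ∀ z → z ∈ₗ leaves t → z ∉ X

StraddlesOnlyAbove : Subset n → Fin n → Fin n → Tree n → Set
StraddlesOnlyAbove X α β (leaf _) = ⊤
StraddlesOnlyAbove X α β (node u v) =
  ((α ∈ₗ leaves (node u v) × β ∈ₗ leaves (node u v)) ⊎ LeavesIn X (node u v) ⊎ LeavesOut X (node u v))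
  × StraddlesOnlyAbove X α β u × StraddlesOnlyAbove X α β v

module _ {X : Subset n} {α β : Fin n} where

  LeavesIn⇒StraddlesOnlyAbove : (t : Tree n) → LeavesIn X t → StraddlesOnlyAbove X α β t
  LeavesIn⇒StraddlesOnlyAbove (leaf x) h = tt
  LeavesIn⇒StraddlesOnlyAbove (node u v) h = inj₂ (inj₁ h) ,
    LeavesIn⇒StraddlesOnlyAbove u (λ z m → h z (∈-++⁺ˡ m)) , LeavesIn⇒StraddlesOnlyAbove v (λ z m → h z (∈-++⁺ʳ (leaves u) m))

  LeavesOut⇒StraddlesOnlyAbove : (t : Tree n) → LeavesOut X t → StraddlesOnlyAbove X α β t
  LeavesOut⇒StraddlesOnlyAbove (leaf x) h = tt
  LeavesOut⇒StraddlesOnlyAbove (node u v) h = inj₂ (inj₂ h) ,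
    LeavesOut⇒StraddlesOnlyAbove u (λ z m → h z (∈-++⁺ˡ m)) , LeavesOut⇒StraddlesOnlyAbove v (λ z m → h z (∈-++⁺ʳ (leaves u) m))

  homogeneous⇒StraddlesOnlyAbove : (t : Tree n) → LeavesIn X t ⊎ LeavesOut X t → StraddlesOnlyAbove X α β t
  homogeneous⇒StraddlesOnlyAbove t = [ LeavesIn⇒StraddlesOnlyAbove t , LeavesOut⇒StraddlesOnlyAbove t ]

  StraddlesOnlyAbove⇒homogeneous : (t : Tree n) → StraddlesOnlyAbove X α β t → ¬ (α ∈ₗ leaves t × β ∈ₗ leaves t) →
    LeavesIn X t ⊎ LeavesOut X t
  StraddlesOnlyAbove⇒homogeneous (leaf x) _ _ with x ∈? X
  ... | yes p = inj₁ λ { z (here refl) → p }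
  ... | no p = inj₂ λ { z (here refl) → p }
  StraddlesOnlyAbove⇒homogeneous (node u v) (inj₁ αβ , _) ∌αβ = ⊥-elim (∌αβ αβ)
  StraddlesOnlyAbove⇒homogeneous (node u v) (inj₂ h , _) _ = h

-- EX = (X ∩ t) ∪ {β} and EY = (t ∖ X) ∪ {α}, up to elements that are not leaves of t.
record GlueSetting (X EX EY : Subset n) (α β : Fin n) (t : Tree n) : Set where
  field
    X⊆EX   : ∀ z → z ∈ₗ leaves t → z ∈ X → z ∈ EX
    β∈EX   : β ∈ EX
    EX∖X⊆β : ∀ z → z ∈ₗ leaves t → z ∈ EX → z ∉ X → z ≡ β
    ∁X⊆EY  : ∀ z → z ∈ₗ leaves t → z ∉ X → z ∈ EY
    α∈EY   : α ∈ EY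
    EY∩X⊆α : ∀ z → z ∈ₗ leaves t → z ∈ EY → z ∈ X → z ≡ α
    α∈X    : α ∈ X
    β∉X    : β ∉ X
open GlueSetting

-- If the restrictions to EX and EY have common layouts τβ and αυ, then τυ is a common layout,
-- provided every vertex straddling X lies above both α and β.
module Gluing {X EX EY : Subset n} {α β : Fin n} where

  private
    Setting : Tree n → Set
    Setting = GlueSetting X EX EY α β

  GlueSetting-narrow : {s t : Tree n} → (∀ {z} → z ∈ₗ leaves s → z ∈ₗ leaves t) → Setting t → Setting s
  GlueSetting-narrow s⊆t h = record
    { X⊆EX = λ z m → X⊆EX h z (s⊆t m) ; β∈EX = β∈EX h ; EX∖X⊆β = λ z m → EX∖X⊆β h z (s⊆t m)
    ; ∁X⊆EY = λ z m → ∁X⊆EY h z (s⊆t m) ; α∈EY = α∈EY h ; EY∩X⊆α = λ z m → EY∩X⊆α h z (s⊆t m)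
    ; α∈X = α∈X h ; β∉X = β∉X h }

  GlueSetting-up : {u v : Tree n} → Setting (node u v) → Setting u
  GlueSetting-up = GlueSetting-narrow ∈-++⁺ˡ

  GlueSetting-down : {u v : Tree n} → Setting (node u v) → Setting v
  GlueSetting-down {u} = GlueSetting-narrow (∈-++⁺ʳ (leaves u))

  restrictX-in : {s : Tree n} → Setting s → LeavesIn X s → restrict EX s ≡ just s
  restrictX-in {s} h s⊆X = restrict-⊇ EX s λ z m → X⊆EX h z m (s⊆X z m)

  restrictX-out : {s : Tree n} → Setting s → LeavesOut X s → β ∉ₗ leaves s → restrict EX s ≡ nothing
  restrictX-out {s} h s⊆∁X β∉s = restrict-disjoint EX s λ z m zE → β∉s (∈-resp-≡ (EX∖X⊆β h z m zE (s⊆∁X z m)) m)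

  restrictX-out-∋β : {s : Tree n} → Setting s → Unique (leaves s) → LeavesOut X s → β ∈ₗ leaves s → restrict EX s ≡ just (leaf β)
  restrictX-out-∋β {s} h u s⊆∁X βs =
    ⇝-leaf⁻ (restrict-single EX s β u βs (β∈EX h) (hitsOnly λ {z} m zE → here (EX∖X⊆β h z m zE (s⊆∁X z m))))

  restrictY-out : {s : Tree n} → Setting s → LeavesOut X s → restrict EY s ≡ just s
  restrictY-out {s} h s⊆∁X = restrict-⊇ EY s λ z m → ∁X⊆EY h z m (s⊆∁X z m)

  restrictY-in : {s : Tree n} → Setting s → LeavesIn X s → α ∉ₗ leaves s → restrict EY s ≡ nothing
  restrictY-in {s} h s⊆X α∉s = restrict-disjoint EY s λ z m zE → α∉s (∈-resp-≡ (EY∩X⊆α h z m zE (s⊆X z m)) m)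

  restrictY-in-∋α : {s : Tree n} → Setting s → Unique (leaves s) → LeavesIn X s → α ∈ₗ leaves s → restrict EY s ≡ just (leaf α)
  restrictY-in-∋α {s} h u s⊆X αs =
    ⇝-leaf⁻ (restrict-single EY s α u αs (α∈EY h) (hitsOnly λ {z} m zE → here (EY∩X⊆α h z m zE (s⊆X z m))))

  GlueGoal : Tree n → Set
  GlueGoal t = {tX tY : Tree n} (τ υ : List (Fin n)) →
    restrict EX t ≡ just tX → Layout tX (τ ++ β ∷ []) → restrict EY t ≡ just tY → Layout tY (α ∷ υ) → Layout t (τ ++ υ)

  glue-layouts : (t : Tree n) → Setting t → StraddlesOnlyAbove X α β t → Unique (leaves t) →
    α ∈ₗ leaves t → β ∈ₗ leaves t → GlueGoal t

  glue-both-up : (u v : Tree n) → Setting (node u v) → StraddlesOnlyAbove X α β u → StraddlesOnlyAbove X α β v →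
    Unique (leaves (node u v)) → α ∈ₗ leaves u → β ∈ₗ leaves u → GlueGoal (node u v)
  glue-both-up u v h gu gv un αu βu τ υ eX lX eY lY
    with StraddlesOnlyAbove⇒homogeneous v gv (λ (α∈v , _) → Unique-++-disjoint un αu α∈v)
  ... | inj₁ v⊆X with restrict-just EX u βu (β∈EX h)
  ...   | uX , eXu with just-injective (restrict-node-just EX u v eX eXu (restrictX-in (GlueSetting-down h) v⊆X))
  ...   | refl with Layout-node-last lX (λ β∈v → β∉X h (v⊆X β β∈v))
  ...   | σ , ρ , lu , lv , refl = subst (Layout (node u v)) (sym (++-assoc ρ σ υ))
          (swap (glue-layouts u (GlueSetting-up h) gu (Unique-++⁻ˡ un) αu βu σ υ eXu lu
              (trans (sym (join-nothingʳ _))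
                  (restrict-node-just EY u v eY refl (restrictY-in (GlueSetting-down h) v⊆X (Unique-++-disjoint un αu)))) lY) lv)
  glue-both-up u v h gu gv un αu βu τ υ eX lX eY lY | inj₂ v⊆∁X with restrict-just EY u αu (α∈EY h)
  ...   | uY , eYu with just-injective (restrict-node-just EY u v eY eYu (restrictY-out (GlueSetting-down h) v⊆∁X))
  ...   | refl with Layout-node-first lY (λ α∈v → v⊆∁X α α∈v (α∈X h))
  ...   | σ , ρ , lu , lv , refl = subst (Layout (node u v)) (++-assoc τ σ ρ)
          (node (glue-layouts u (GlueSetting-up h) gu (Unique-++⁻ˡ un) αu βu τ σ
              (trans (sym (join-nothingʳ _))
                  (restrict-node-just EX u v eX refl (restrictX-out (GlueSetting-down h) v⊆∁X (Unique-++-disjoint un βu)))) lX eYu lu) lv)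

  glue-both-down : (u v : Tree n) → Setting (node u v) → StraddlesOnlyAbove X α β u → StraddlesOnlyAbove X α β v →
    Unique (leaves (node u v)) → α ∈ₗ leaves v → β ∈ₗ leaves v → GlueGoal (node u v)
  glue-both-down u v h gu gv un αv βv τ υ eX lX eY lY
    with StraddlesOnlyAbove⇒homogeneous u gu (λ (α∈u , _) → Unique-++-disjoint un α∈u αv)
  ... | inj₁ u⊆X with restrict-just EX v βv (β∈EX h)
  ...   | vX , eXv with just-injective (restrict-node-just EX u v eX (restrictX-in (GlueSetting-up h) u⊆X) eXv)
  ...   | refl with Layout-node-last (Layout-resp-∼ (swap ∼-refl ∼-refl) lX) (λ β∈u → β∉X h (u⊆X β β∈u))
  ...   | σ , ρ , lv , lu , refl = subst (Layout (node u v)) (sym (++-assoc ρ σ υ))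
          (node lu (glue-layouts v (GlueSetting-down h) gv (Unique-++⁻ʳ {xs = leaves u} un) αv βv σ υ eXv lv
              (restrict-node-just EY u v eY (restrictY-in (GlueSetting-up h) u⊆X (λ α∈u → Unique-++-disjoint un α∈u αv)) refl) lY))
  glue-both-down u v h gu gv un αv βv τ υ eX lX eY lY | inj₂ u⊆∁X with restrict-just EY v αv (α∈EY h)
  ...   | vY , eYv with just-injective (restrict-node-just EY u v eY (restrictY-out (GlueSetting-up h) u⊆∁X) eYv)
  ...   | refl with Layout-node-first (Layout-resp-∼ (swap ∼-refl ∼-refl) lY) (λ α∈u → u⊆∁X α α∈u (α∈X h))
  ...   | σ , ρ , lv , lu , refl = subst (Layout (node u v)) (++-assoc τ σ ρ)
          (swap lu (glue-layouts v (GlueSetting-down h) gv (Unique-++⁻ʳ {xs = leaves u} un) αv βv τ σ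
              (restrict-node-just EX u v eX (restrictX-out (GlueSetting-up h) u⊆∁X (λ β∈u → Unique-++-disjoint un β∈u βv)) refl) lX eYv lv))

  glue-apart : (u v : Tree n) → Setting (node u v) → StraddlesOnlyAbove X α β u → StraddlesOnlyAbove X α β v →
    Unique (leaves (node u v)) → α ∈ₗ leaves u → β ∈ₗ leaves v → GlueGoal (node u v)
  glue-apart u v h gu gv un αu βv τ υ eX lX eY lY
    with StraddlesOnlyAbove⇒homogeneous u gu (λ (_ , β∈u) → Unique-++-disjoint un β∈u βv)
       | StraddlesOnlyAbove⇒homogeneous v gv (λ (α∈v , _) → Unique-++-disjoint un αu α∈v)
  ... | inj₂ u⊆∁X | _ = ⊥-elim (u⊆∁X α αu (α∈X h))
  ... | inj₁ _ | inj₁ v⊆X = ⊥-elim (β∉X h (v⊆X β βv))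
  ... | inj₁ u⊆X | inj₂ v⊆∁X
    with just-injective (restrict-node-just EX u v eX (restrictX-in (GlueSetting-up h) u⊆X)
        (restrictX-out-∋β (GlueSetting-down h) (Unique-++⁻ʳ {xs = leaves u} un) v⊆∁X βv))
       | just-injective (restrict-node-just EY u v eY (restrictY-in-∋α (GlueSetting-up h) (Unique-++⁻ˡ un) u⊆X αu)
           (restrictY-out (GlueSetting-down h) v⊆∁X))
  ...   | refl | refl = node (Layout-init (λ β∈u → β∉X h (u⊆X β β∈u)) lX) (Layout-tail (λ α∈v → v⊆∁X α α∈v (α∈X h)) lY)

  glue-apart-swapped : (u v : Tree n) → Setting (node u v) → StraddlesOnlyAbove X α β u → StraddlesOnlyAbove X α β v →
    Unique (leaves (node u v)) → α ∈ₗ leaves v → β ∈ₗ leaves u → GlueGoal (node u v)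
  glue-apart-swapped u v h gu gv un αv βu τ υ eX lX eY lY
    with StraddlesOnlyAbove⇒homogeneous u gu (λ (α∈u , _) → Unique-++-disjoint un α∈u αv)
       | StraddlesOnlyAbove⇒homogeneous v gv (λ (_ , β∈v) → Unique-++-disjoint un βu β∈v)
  ... | inj₁ u⊆X | _ = ⊥-elim (β∉X h (u⊆X β βu))
  ... | inj₂ _ | inj₂ v⊆∁X = ⊥-elim (v⊆∁X α αv (α∈X h))
  ... | inj₂ u⊆∁X | inj₁ v⊆X
    with just-injective (restrict-node-just EX u v eX (restrictX-out-∋β (GlueSetting-up h) (Unique-++⁻ˡ un) u⊆∁X βu)
        (restrictX-in (GlueSetting-down h) v⊆X))
       | just-injective (restrict-node-just EY u v eY (restrictY-out (GlueSetting-up h) u⊆∁X)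
           (restrictY-in-∋α (GlueSetting-down h) (Unique-++⁻ʳ {xs = leaves u} un) v⊆X αv))
  ...   | refl | refl = swap (Layout-tail (λ α∈u → u⊆∁X α α∈u (α∈X h)) (Layout-resp-∼ (swap ∼-refl ∼-refl) lY))
                             (Layout-init (λ β∈v → β∉X h (v⊆X β β∈v)) (Layout-resp-∼ (swap ∼-refl ∼-refl) lX))

  glue-layouts (leaf x) h _ _ (here refl) (here refl) _ _ _ _ _ _ = ⊥-elim (β∉X h (α∈X h))
  glue-layouts (node u v) h (_ , gu , gv) un mα mβ with ∈-++⁻ (leaves u) mα | ∈-++⁻ (leaves u) mβ
  ... | inj₁ αu | inj₁ βu = glue-both-up u v h gu gv un αu βu
  ... | inj₂ αv | inj₂ βv = glue-both-down u v h gu gv un αv βv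
  ... | inj₁ αu | inj₂ βv = glue-apart u v h gu gv un αu βv
  ... | inj₂ αv | inj₁ βu = glue-apart-swapped u v h gu gv un αv βu

open Gluing using (glue-layouts)

-- Common layout or induced T₁ or T₂

record SameLeaves {n : ℕ} (L′ R′ : Tree n) : Set where
  constructor same-leaves
  field
    uniqueˡ : Unique (leaves L′)
    uniqueʳ : Unique (leaves R′)
    ⊆ʳ : ∀ z → z ∈ₗ leaves L′ → z ∈ₗ leaves R′
    ⊆ˡ : ∀ z → z ∈ₗ leaves R′ → z ∈ₗ leaves L′
open SameLeaves public

SameLeaves-swap : {L′ R′ : Tree n} → SameLeaves L′ R′ → SameLeaves R′ L′
SameLeaves-swap (same-leaves uL uR L⊆R R⊆L) = same-leaves uR uL R⊆L L⊆R

SameLeaves-resp-∼ : {L₁ L₂ R₁ R₂ : Tree n} → L₁ ∼ L₂ → R₁ ∼ R₂ → SameLeaves L₁ R₁ → SameLeaves L₂ R₂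
SameLeaves-resp-∼ pL pR (same-leaves uL uR L⊆R R⊆L) =
  same-leaves (Layout-unique (∼⇒Layout pL) uL) (Layout-unique (∼⇒Layout pR) uR)
    (λ z m → ∼-∈ pR (L⊆R z (∼-∈ (∼-sym pL) m))) (λ z m → ∼-∈ pL (R⊆L z (∼-∈ (∼-sym pR) m)))

SameLeaves-restrict : (E : Subset n) {L₁ R₁ L′ R′ : Tree n} → SameLeaves L₁ R₁ →
  restrict E L₁ ≡ just L′ → restrict E R₁ ≡ just R′ → SameLeaves L′ R′
SameLeaves-restrict E {L₁} {R₁} {L′} {R′} (same-leaves uL uR L⊆R R⊆L) eL eR =
  same-leaves (subst Unique (sym eqL) (filter⁺ (_∈? E) uL)) (subst Unique (sym eqR) (filter⁺ (_∈? E) uR))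
    (λ z m → let (m₁ , zE) = restrict-∈⁻ E L₁ L′ eL m in subst (z ∈ₗ_) (sym eqR) (∈-filter⁺ (_∈? E) (L⊆R z m₁) zE))
    (λ z m → let (m₁ , zE) = restrict-∈⁻ E R₁ R′ eR m in subst (z ∈ₗ_) (sym eqL) (∈-filter⁺ (_∈? E) (R⊆L z m₁) zE))
  where
  eqL : leaves L′ ≡ keep E (leaves L₁)
  eqL = leaves-restrict-just E L₁ eL
  eqR : leaves R′ ≡ keep E (leaves R₁)
  eqR = leaves-restrict-just E R₁ eR

Tanglegram-SameLeaves : (T : Tanglegram n) → SameLeaves (L T) (R T)
Tanglegram-SameLeaves {n} T = same-leaves
  (Unique-resp-↭ (↭-sym (L-ok T)) (allFin⁺ n)) (Unique-resp-↭ (↭-sym (R-ok T)) (allFin⁺ n))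
  (λ z _ → R-∋ T z) (λ z _ → L-∋ T z)

Dichotomy : Tree n → Tree n → Set
Dichotomy L′ R′ = CommonLayout L′ R′ ⊎ Obstructed L′ R′

Dichotomy-resp-∼ : {L₁ L₂ R₁ R₂ : Tree n} → L₁ ∼ L₂ → R₁ ∼ R₂ → Dichotomy L₂ R₂ → Dichotomy L₁ R₁
Dichotomy-resp-∼ pL pR (inj₁ (σ , lL , lR)) = inj₁ (σ , Layout-resp-∼ pL lL , Layout-resp-∼ pR lR)
Dichotomy-resp-∼ pL pR (inj₂ o) = inj₂ (Obstructed-resp-∼ pL pR o)

Dichotomy-swap : {L′ R′ : Tree n} → Dichotomy L′ R′ → Dichotomy R′ L′
Dichotomy-swap (inj₁ (σ , lL , lR)) = inj₁ (σ , lR , lL)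
Dichotomy-swap {L′ = L′} {R′} (inj₂ o) = inj₂ (Obstructed-swap {L′ = L′} {R′} o)

size : Tree n → ℕ
size t = length (leaves t)

size-resp-∼ : {t s : Tree n} → t ∼ s → size t ≡ size s
size-resp-∼ p = sym (↭-length (Layout-↭ (∼⇒Layout p)))

DichotomyBelow : ℕ → ℕ → Set
DichotomyBelow n m = ∀ (L′ R′ : Tree n) → size L′ + size R′ < m → SameLeaves L′ R′ → Dichotomy L′ R′

DichotomyFor : Tree n → Tree n → Set
DichotomyFor {n} L′ R′ = DichotomyBelow n (size L′ + size R′)

DichotomyFor-swap : (L′ R′ : Tree n) → DichotomyFor L′ R′ → DichotomyFor R′ L′
DichotomyFor-swap {n} L′ R′ = subst (DichotomyBelow n) (+-comm (size L′) (size R′))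

dichotomy-via-∼ : {L₁ L₂ R₁ R₂ : Tree n} → L₁ ∼ L₂ → R₁ ∼ R₂ → DichotomyFor L₁ R₁ → SameLeaves L₁ R₁ →
  (DichotomyFor L₂ R₂ → SameLeaves L₂ R₂ → Dichotomy L₂ R₂) → Dichotomy L₁ R₁
dichotomy-via-∼ {n} pL pR rec W k =
  Dichotomy-resp-∼ pL pR (k (subst (DichotomyBelow n) (cong₂ _+_ (size-resp-∼ pL) (size-resp-∼ pR)) rec) (SameLeaves-resp-∼ pL pR W))

some-leaf : (t : BT A) → Σ[ x ∈ A ] x ∈ₗ leaves t
some-leaf (leaf x) = x , here refl
some-leaf (node u d) = let (x , m) = some-leaf u in x , ∈-++⁺ˡ m

TwoLeaves : Tree n → Set
TwoLeaves {n} t = ∀ (z : Fin n) → Σ[ w ∈ Fin n ] (w ∈ₗ leaves t × w ≢ z)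

node-TwoLeaves : (a b : Tree n) → Unique (leaves (node a b)) → TwoLeaves (node a b)
node-TwoLeaves a b u z with some-leaf a | some-leaf b
... | x , mx | y , my with x ≟F z
... | no x≢z = x , ∈-++⁺ˡ mx , x≢z
... | yes refl = y , ∈-++⁺ʳ (leaves a) my , ≢-sym (Unique-++-≢ u mx my)

find-∈ : (X : Subset n) (xs : List (Fin n)) → (Σ[ x ∈ Fin n ] (x ∈ₗ xs × x ∈ X)) ⊎ (∀ x → x ∈ₗ xs → x ∉ X)
find-∈ X [] = inj₂ λ x ()
find-∈ X (y ∷ ys) with y ∈? X | find-∈ X ys
... | yes p | _ = inj₁ (y , here refl , p)
... | no _ | inj₁ (x , m , q) = inj₁ (x , there m , q)
... | no p | inj₂ h = inj₂ λ { x (here refl) → p ; x (there m) → h x m }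

find-∉ : (X : Subset n) (xs : List (Fin n)) → (Σ[ x ∈ Fin n ] (x ∈ₗ xs × x ∉ X)) ⊎ (∀ x → x ∈ₗ xs → x ∈ X)
find-∉ X [] = inj₂ λ x ()
find-∉ X (y ∷ ys) with y ∈? X | find-∉ X ys
... | no p | _ = inj₁ (y , here refl , p)
... | yes _ | inj₁ (x , m , q) = inj₁ (x , there m , q)
... | yes p | inj₂ h = inj₂ λ { x (here refl) → p ; x (there m) → h x m }

Straddles : Subset n → Tree n → Set
Straddles {n} X t = (Σ[ x ∈ Fin n ] (x ∈ₗ leaves t × x ∈ X)) × (Σ[ y ∈ Fin n ] (y ∈ₗ leaves t × y ∉ X))

straddles? : (X : Subset n) (t : Tree n) → Straddles X t ⊎ (LeavesIn X t ⊎ LeavesOut X t)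
straddles? X t with find-∈ X (leaves t) | find-∉ X (leaves t)
... | inj₂ t⊆∁X | _ = inj₂ (inj₂ t⊆∁X)
... | inj₁ _ | inj₂ t⊆X = inj₂ (inj₁ t⊆X)
... | inj₁ x | inj₁ y = inj₁ (x , y)

Children : Tree n → Tree n → Tree n → Set
Children w a b = w ≡ node a b ⊎ w ≡ node b a

Children-∈ˡ : {w a b : Tree n} {z : Fin n} → Children w a b → z ∈ₗ leaves a → z ∈ₗ leaves w
Children-∈ˡ (inj₁ refl) m = ∈-++⁺ˡ m
Children-∈ˡ {b = b} (inj₂ refl) m = ∈-++⁺ʳ (leaves b) m

Children-∈ʳ : {w a b : Tree n} {z : Fin n} → Children w a b → z ∈ₗ leaves b → z ∈ₗ leaves w
Children-∈ʳ {a = a} (inj₁ refl) m = ∈-++⁺ʳ (leaves a) m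
Children-∈ʳ (inj₂ refl) m = ∈-++⁺ˡ m

Children-∈⁻ : {w a b : Tree n} {z : Fin n} → Children w a b → z ∈ₗ leaves w → z ∈ₗ leaves a ⊎ z ∈ₗ leaves b
Children-∈⁻ {a = a} (inj₁ refl) m = ∈-++⁻ (leaves a) m
Children-∈⁻ {b = b} (inj₂ refl) m = Sum.swap (∈-++⁻ (leaves b) m)

Children-unique : {w a b : Tree n} → Children w a b → Unique (leaves w) → Unique (leaves b)
Children-unique {a = a} (inj₁ refl) u = Unique-++⁻ʳ {xs = leaves a} u
Children-unique (inj₂ refl) u = Unique-++⁻ˡ u

-- Either two sibling subtrees both straddle X, or some vertex w has one child inside X and one outside,
-- and then every straddling vertex lies above w.
data StraddleShape {n : ℕ} (X : Subset n) (t : Tree n) : Set where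
  straddling-siblings : (r₁ r₂ : Tree n) → Subtree (node r₁ r₂) t → (x₁ y₁ x₂ y₂ : Fin n) →
    x₁ ∈ₗ leaves r₁ → y₁ ∈ₗ leaves r₁ → x₂ ∈ₗ leaves r₂ → y₂ ∈ₗ leaves r₂ →
    x₁ ∈ X → y₁ ∉ X → x₂ ∈ X → y₂ ∉ X → StraddleShape X t
  separating-vertex : (w rᵢ rₒ : Tree n) → Subtree w t → Children w rᵢ rₒ → LeavesIn X rᵢ → LeavesOut X rₒ →
    (∀ α β → α ∈ₗ leaves rᵢ → β ∈ₗ leaves rₒ → StraddlesOnlyAbove X α β t) → StraddleShape X t

StraddleShape-up : {X : Subset n} {u v : Tree n} → LeavesIn X v ⊎ LeavesOut X v → StraddleShape X u → StraddleShape X (node u v)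
StraddleShape-up _ (straddling-siblings r₁ r₂ sb x₁ y₁ x₂ y₂ m₁ n₁ m₂ n₂ p₁ q₁ p₂ q₂) =
  straddling-siblings r₁ r₂ (up sb) x₁ y₁ x₂ y₂ m₁ n₁ m₂ n₂ p₁ q₁ p₂ q₂
StraddleShape-up {v = v} hv (separating-vertex w rᵢ rₒ sb ch i o above) = separating-vertex w rᵢ rₒ (up sb) ch i o λ α β mα mβ →
  inj₁ (∈-++⁺ˡ (Subtree-∈ sb (Children-∈ˡ ch mα)) , ∈-++⁺ˡ (Subtree-∈ sb (Children-∈ʳ ch mβ))) ,
  above α β mα mβ , homogeneous⇒StraddlesOnlyAbove v hv

StraddleShape-down : {X : Subset n} {u v : Tree n} → LeavesIn X u ⊎ LeavesOut X u → StraddleShape X v → StraddleShape X (node u v)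
StraddleShape-down _ (straddling-siblings r₁ r₂ sb x₁ y₁ x₂ y₂ m₁ n₁ m₂ n₂ p₁ q₁ p₂ q₂) =
  straddling-siblings r₁ r₂ (down sb) x₁ y₁ x₂ y₂ m₁ n₁ m₂ n₂ p₁ q₁ p₂ q₂
StraddleShape-down {u = u} hu (separating-vertex w rᵢ rₒ sb ch i o above) = separating-vertex w rᵢ rₒ (down sb) ch i o λ α β mα mβ →
  inj₁ (∈-++⁺ʳ (leaves u) (Subtree-∈ sb (Children-∈ˡ ch mα)) , ∈-++⁺ʳ (leaves u) (Subtree-∈ sb (Children-∈ʳ ch mβ))) ,
  homogeneous⇒StraddlesOnlyAbove u hu , above α β mα mβ

straddle-shape : (X : Subset n) (t : Tree n) → Straddles X t → StraddleShape X t
straddle-shape X (leaf x) ((_ , here refl , x∈X) , (_ , here refl , x∉X)) = ⊥-elim (x∉X x∈X)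
straddle-shape X (node u v) s with straddles? X u | straddles? X v
... | inj₁ ((x₁ , m₁ , p₁) , (y₁ , n₁ , q₁)) | inj₁ ((x₂ , m₂ , p₂) , (y₂ , n₂ , q₂)) =
  straddling-siblings u v here x₁ y₁ x₂ y₂ m₁ n₁ m₂ n₂ p₁ q₁ p₂ q₂
... | inj₁ su | inj₂ hv = StraddleShape-up hv (straddle-shape X u su)
... | inj₂ hu | inj₁ sv = StraddleShape-down hu (straddle-shape X v sv)
... | inj₂ (inj₁ u⊆X) | inj₂ (inj₂ v⊆∁X) = separating-vertex (node u v) u v here (inj₁ refl) u⊆X v⊆∁X λ α β mα mβ →
  inj₁ (∈-++⁺ˡ mα , ∈-++⁺ʳ (leaves u) mβ) , LeavesIn⇒StraddlesOnlyAbove u u⊆X , LeavesOut⇒StraddlesOnlyAbove v v⊆∁X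
... | inj₂ (inj₂ u⊆∁X) | inj₂ (inj₁ v⊆X) = separating-vertex (node u v) v u here (inj₂ refl) v⊆X u⊆∁X λ α β mα mβ →
  inj₁ (∈-++⁺ʳ (leaves u) mα , ∈-++⁺ˡ mβ) , LeavesOut⇒StraddlesOnlyAbove u u⊆∁X , LeavesIn⇒StraddlesOnlyAbove v v⊆X
straddle-shape X (node u v) (_ , (y , my , y∉X)) | inj₂ (inj₁ u⊆X) | inj₂ (inj₁ v⊆X) =
  ⊥-elim (y∉X ([ u⊆X y , v⊆X y ] (∈-++⁻ (leaves u) my)))
straddle-shape X (node u v) ((x , mx , x∈X) , _) | inj₂ (inj₂ u⊆∁X) | inj₂ (inj₂ v⊆∁X) =
  ⊥-elim ([ (λ m → u⊆∁X x m x∈X) , (λ m → v⊆∁X x m x∈X) ] (∈-++⁻ (leaves u) mx))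

record RestrictedLayout {n : ℕ} (E : Subset n) (L₁ R₁ : Tree n) (σ : List (Fin n)) : Set where
  constructor restricted
  field
    {Lᴱ Rᴱ} : Tree n
    eqˡ : restrict E L₁ ≡ just Lᴱ
    eqʳ : restrict E R₁ ≡ just Rᴱ
    layoutˡ : Layout Lᴱ σ
    layoutʳ : Layout Rᴱ σ

RestrictedLayout-ending : (E : Subset n) {L₁ R₁ a : Tree n} {β : Fin n} {σ : List (Fin n)} → restrict E L₁ ≡ just (node a (leaf β)) →
  RestrictedLayout E L₁ R₁ σ → Σ[ τ ∈ List (Fin n) ] RestrictedLayout E L₁ R₁ (τ ++ β ∷ [])
RestrictedLayout-ending E e (restricted eL eR lL lR) with just-injective (trans (sym e) eL)
... | refl with layout-ending-with lL lR
... | τ , lL′ , lR′ = τ , restricted eL eR lL′ lR′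

RestrictedLayout-starting : (E : Subset n) {L₁ R₁ b : Tree n} {α : Fin n} {σ : List (Fin n)} → restrict E L₁ ≡ just (node (leaf α) b) →
  RestrictedLayout E L₁ R₁ σ → Σ[ υ ∈ List (Fin n) ] RestrictedLayout E L₁ R₁ (α ∷ υ)
RestrictedLayout-starting E e (restricted eL eR lL lR) with just-injective (trans (sym e) eL)
... | refl with layout-starting-with lL lR
... | υ , lL′ , lR′ = υ , restricted eL eR lL′ lR′

-- Restricting to E drops the leaf z ∉ E, so the induction hypothesis applies.
restrict-dichotomy : {L₁ R₁ : Tree n} → DichotomyFor L₁ R₁ → SameLeaves L₁ R₁ → (E : Subset n) {z w : Fin n} →
  z ∈ₗ leaves L₁ → z ∉ E → w ∈ₗ leaves L₁ → w ∈ E → Obstructed L₁ R₁ ⊎ Σ[ σ ∈ List (Fin n) ] RestrictedLayout E L₁ R₁ σ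
restrict-dichotomy {L₁ = L₁} {R₁} rec W E {z} {w} mz zE mw wE with restrict-just E L₁ mw wE | restrict-just E R₁ (⊆ʳ W w mw) wE
... | L′ , eL | R′ , eR with rec L′ R′ (+-mono-<-≤ shorterˡ shorterʳ) (SameLeaves-restrict E W eL eR)
  where
  shorterʳ : size R′ ≤ size R₁
  shorterʳ = subst (λ l → length l ≤ size R₁) (sym (leaves-restrict-just E R₁ eR)) (length-filter (_∈? E) (leaves R₁))
  shorterˡ : size L′ < size L₁
  shorterˡ = subst (λ l → length l < size L₁) (sym (leaves-restrict-just E L₁ eL))
    (filter-notAll (_∈? E) (leaves L₁) (Any.map (λ { refl → zE }) mz))
... | inj₁ (σ , lL , lR) = inj₂ (σ , restricted eL eR lL lR)
... | inj₂ o = inj₁ (Obstructed-unrestrict E {L₁} {R₁} {L′} {R′} eL eR o)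

∉-fromList-∷ : {x y : Fin n} (xs : List (Fin n)) → y ≢ x → y ∉ₗ xs → y ∉ fromList (x ∷ xs)
∉-fromList-∷ xs y≢x y∉xs m with fromList⁻ (_ ∷ xs) m
... | here e = y≢x e
... | there m′ = y∉xs m′

fromList-GlueSetting : (xs ys : List (Fin n)) {α β : Fin n} (t : Tree n) → α ∈ₗ xs → β ∈ₗ ys →
  (∀ {z} → z ∈ₗ xs → z ∈ₗ ys → ⊥) → (∀ {z} → z ∈ₗ leaves t → z ∈ₗ xs ⊎ z ∈ₗ ys) →
  GlueSetting (fromList xs) (fromList (β ∷ xs)) (fromList (α ∷ ys)) α β t
fromList-GlueSetting xs ys {α} {β} t αxs βys disjoint cover = record
  { X⊆EX = λ z _ zX → fromList⁺ (β ∷ xs) (there (fromList⁻ xs zX))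
  ; β∈EX = fromList⁺ (β ∷ xs) (here refl)
  ; EX∖X⊆β = λ z _ zE z∉X → EX∖X (fromList⁻ (β ∷ xs) zE) z∉X
  ; ∁X⊆EY = λ z m z∉X → fromList⁺ (α ∷ ys) (there ([ (λ zxs → ⊥-elim (z∉X (fromList⁺ xs zxs))) , (λ zys → zys) ] (cover m)))
  ; α∈EY = fromList⁺ (α ∷ ys) (here refl)
  ; EY∩X⊆α = λ z _ zE zX → EY∩X (fromList⁻ (α ∷ ys) zE) (fromList⁻ xs zX)
  ; α∈X = fromList⁺ xs αxs
  ; β∉X = λ βX → disjoint (fromList⁻ xs βX) βys }
  where
  EX∖X : ∀ {z} → z ∈ₗ (β ∷ xs) → z ∉ fromList xs → z ≡ β
  EX∖X (here e) _ = e
  EX∖X (there m) z∉X = ⊥-elim (z∉X (fromList⁺ xs m))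
  EY∩X : ∀ {z} → z ∈ₗ (α ∷ ys) → z ∈ₗ xs → z ≡ α
  EY∩X (here e) _ = e
  EY∩X (there m) zxs = ⊥-elim (disjoint zxs m)

glue-common-layouts : {X EX EY : Subset n} {α β : Fin n} {L′ R′ : Tree n} →
  GlueSetting X EX EY α β L′ → GlueSetting X EX EY α β R′ → StraddlesOnlyAbove X α β L′ → StraddlesOnlyAbove X α β R′ →
  SameLeaves L′ R′ → α ∈ₗ leaves L′ → β ∈ₗ leaves L′ → (τ υ : List (Fin n)) →
  RestrictedLayout EX L′ R′ (τ ++ β ∷ []) → RestrictedLayout EY L′ R′ (α ∷ υ) → CommonLayout L′ R′
glue-common-layouts {L′ = L′} {R′} hL hR aboveL aboveR W αL βL τ υ (restricted eLX eRX lLX lRX) (restricted eLY eRY lLY lRY) =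
  τ ++ υ , glue-layouts L′ hL aboveL (uniqueˡ W) αL βL τ υ eLX lLX eLY lLY
         , glue-layouts R′ hR aboveR (uniqueʳ W) (⊆ʳ W _ αL) (⊆ʳ W _ βL) τ υ eRX lRX eRY lRY

restrict-up-and-leaf : (a b : Tree n) {β : Fin n} → Unique (leaves (node a b)) → β ∈ₗ leaves b →
  restrict (fromList (β ∷ leaves a)) (node a b) ≡ just (node a (leaf β))
restrict-up-and-leaf a b {β} u βb = trans (restrict-node E a b) (cong₂ join
  (restrict-⊇ E a λ z m → fromList⁺ (β ∷ leaves a) (there m))
  (⇝-leaf⁻ (restrict-single E b β (Unique-++⁻ʳ {xs = leaves a} u) βb (fromList⁺ (β ∷ leaves a) (here refl))
    (HitsOnly-narrow (fromList-HitsOnly (β ∷ leaves a)) λ { (here refl) _ → here refl ; (there za) zb → ⊥-elim (Unique-++-disjoint u za zb) }))))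
  where
  E : Subset _
  E = fromList (β ∷ leaves a)

restrict-leaf-and-down : (a b : Tree n) {α : Fin n} → Unique (leaves (node a b)) → α ∈ₗ leaves a →
  restrict (fromList (α ∷ leaves b)) (node a b) ≡ just (node (leaf α) b)
restrict-leaf-and-down a b {α} u αa = trans (restrict-node E a b) (cong₂ join
  (⇝-leaf⁻ (restrict-single E a α (Unique-++⁻ˡ u) αa (fromList⁺ (α ∷ leaves b) (here refl))
    (HitsOnly-narrow (fromList-HitsOnly (α ∷ leaves b)) λ { (here refl) _ → here refl ; (there zb) za → ⊥-elim (Unique-++-disjoint u za zb) })))
  (restrict-⊇ E b λ z m → fromList⁺ (α ∷ leaves b) (there m)))
  where
  E : Subset _
  E = fromList (α ∷ leaves b)

SameLeaves-∉-up : {L₁ L₂ R′ : Tree n} {z : Fin n} → SameLeaves (node L₁ L₂) R′ → z ∈ₗ leaves R′ →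
  z ∉ fromList (leaves L₁) → z ∈ₗ leaves L₂
SameLeaves-∉-up {L₁ = L₁} W m z∉ = [ (λ zL₁ → ⊥-elim (z∉ (fromList⁺ (leaves L₁) zL₁))) , (λ zL₂ → zL₂) ] (∈-++⁻ (leaves L₁) (⊆ˡ W _ m))

SameLeaves-straddles : {L₁ L₂ R′ : Tree n} → SameLeaves (node L₁ L₂) R′ → Straddles (fromList (leaves L₁)) R′
SameLeaves-straddles {L₁ = L₁} {L₂} W with some-leaf L₁ | some-leaf L₂
... | x , mx | y , my = (x , ⊆ʳ W x (∈-++⁺ˡ mx) , fromList⁺ (leaves L₁) mx)
                      , (y , ⊆ʳ W y (∈-++⁺ʳ (leaves L₁) my) , λ yX → Unique-++-disjoint (uniqueˡ W) (fromList⁻ (leaves L₁) yX) my)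

-- Restrict to L₁ plus β and to α plus L₂; both are smaller as L₁ and L₂ have two leaves.
dichotomy-split-root : (L₁ L₂ R′ : Tree n) → DichotomyFor (node L₁ L₂) R′ → SameLeaves (node L₁ L₂) R′ →
  TwoLeaves L₁ → TwoLeaves L₂ → (α β : Fin n) → α ∈ₗ leaves L₁ → β ∈ₗ leaves L₂ →
  StraddlesOnlyAbove (fromList (leaves L₁)) α β R′ → Dichotomy (node L₁ L₂) R′
dichotomy-split-root L₁ L₂ R′ rec W big₁ big₂ α β αL₁ βL₂ aboveR =
  combine (restrict-dichotomy rec W EX (∈-++⁺ʳ (leaves L₁) zX∈L₂) zX∉EX (∈-++⁺ʳ (leaves L₁) βL₂) (β∈EX hL))
          (restrict-dichotomy rec W EY (∈-++⁺ˡ zY∈L₁) zY∉EY (∈-++⁺ˡ αL₁) (α∈EY hL))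
  where
  uL : Unique (leaves (node L₁ L₂))
  uL = uniqueˡ W
  X EX EY : Subset _
  X = fromList (leaves L₁)
  EX = fromList (β ∷ leaves L₁)
  EY = fromList (α ∷ leaves L₂)
  disjoint : ∀ {z} → z ∈ₗ leaves L₁ → z ∈ₗ leaves L₂ → ⊥
  disjoint = Unique-++-disjoint uL
  hL : GlueSetting X EX EY α β (node L₁ L₂)
  hL = fromList-GlueSetting (leaves L₁) (leaves L₂) (node L₁ L₂) αL₁ βL₂ disjoint (∈-++⁻ (leaves L₁))
  hR : GlueSetting X EX EY α β R′
  hR = fromList-GlueSetting (leaves L₁) (leaves L₂) R′ αL₁ βL₂ disjoint (λ m → ∈-++⁻ (leaves L₁) (⊆ˡ W _ m))
  aboveL : StraddlesOnlyAbove X α β (node L₁ L₂)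
  aboveL = inj₁ (∈-++⁺ˡ αL₁ , ∈-++⁺ʳ (leaves L₁) βL₂) , LeavesIn⇒StraddlesOnlyAbove L₁ (λ _ → fromList⁺ (leaves L₁)) ,
           LeavesOut⇒StraddlesOnlyAbove L₂ (λ _ m zX → disjoint (fromList⁻ (leaves L₁) zX) m)
  zX∈L₂ : proj₁ (big₂ β) ∈ₗ leaves L₂
  zX∈L₂ = proj₁ (proj₂ (big₂ β))
  zX∉EX : proj₁ (big₂ β) ∉ EX
  zX∉EX = ∉-fromList-∷ (leaves L₁) (proj₂ (proj₂ (big₂ β))) (λ m → disjoint m zX∈L₂)
  zY∈L₁ : proj₁ (big₁ α) ∈ₗ leaves L₁
  zY∈L₁ = proj₁ (proj₂ (big₁ α))
  zY∉EY : proj₁ (big₁ α) ∉ EY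
  zY∉EY = ∉-fromList-∷ (leaves L₂) (proj₂ (proj₂ (big₁ α))) (disjoint zY∈L₁)
  combine : Obstructed (node L₁ L₂) R′ ⊎ Σ[ σ ∈ List (Fin _) ] RestrictedLayout EX (node L₁ L₂) R′ σ →
            Obstructed (node L₁ L₂) R′ ⊎ Σ[ σ ∈ List (Fin _) ] RestrictedLayout EY (node L₁ L₂) R′ σ → Dichotomy (node L₁ L₂) R′
  combine (inj₁ o) _ = inj₂ o
  combine (inj₂ _) (inj₁ o) = inj₂ o
  combine (inj₂ (_ , rX)) (inj₂ (_ , rY))
    with RestrictedLayout-ending EX (restrict-up-and-leaf L₁ L₂ uL βL₂) rX
       | RestrictedLayout-starting EY (restrict-leaf-and-down L₁ L₂ uL αL₁) rY
  ... | τ , rX′ | υ , rY′ = inj₁ (glue-common-layouts hL hR aboveL aboveR W (∈-++⁺ˡ αL₁) (∈-++⁺ʳ (leaves L₁) βL₂) τ υ rX′ rY′)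

dichotomy-two-big-children : (L₁ L₂ R′ : Tree n) → DichotomyFor (node L₁ L₂) R′ → SameLeaves (node L₁ L₂) R′ →
  TwoLeaves L₁ → TwoLeaves L₂ → Dichotomy (node L₁ L₂) R′
dichotomy-two-big-children L₁ L₂ R′ rec W big₁ big₂ with straddle-shape (fromList (leaves L₁)) R′ (SameLeaves-straddles W)
... | straddling-siblings r₁ r₂ sb x₁ y₁ x₂ y₂ mx₁ my₁ mx₂ my₂ px₁ py₁ px₂ py₂ =
  inj₂ (inj₂ (induces-T₂ L₁ L₂ r₁ r₂ here sb (uniqueˡ W) (uniqueʳ W) x₁ x₂ y₁ y₂
    (fromList⁻ (leaves L₁) px₁) (fromList⁻ (leaves L₁) px₂)
    (SameLeaves-∉-up W (Subtree-∈ sb (∈-++⁺ˡ my₁)) py₁) (SameLeaves-∉-up W (Subtree-∈ sb (∈-++⁺ʳ (leaves r₁) my₂)) py₂)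
    mx₁ my₁ mx₂ my₂))
... | separating-vertex w rᵢ rₒ sb ch i o above with some-leaf rᵢ | some-leaf rₒ
... | α , αᵢ | β , βₒ = dichotomy-split-root L₁ L₂ R′ rec W big₁ big₂ α β (fromList⁻ (leaves L₁) (i α αᵢ))
  (SameLeaves-∉-up W (Subtree-∈ sb (Children-∈ʳ ch βₒ)) (o β βₒ)) (above α β αᵢ βₒ)

dichotomy-cross-pendant-leaf : (Q R₁ : Tree n) (b d : Fin n) →
  DichotomyFor (node (node (leaf d) Q) (leaf b)) (node R₁ (leaf d)) → SameLeaves (node (node (leaf d) Q) (leaf b)) (node R₁ (leaf d)) →
  Dichotomy (node (node (leaf d) Q) (leaf b)) (node R₁ (leaf d))
dichotomy-cross-pendant-leaf Q R₁ b d rec W =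
  finish (restrict-dichotomy rec W E (here refl) d∉E (∈-++⁺ʳ (d ∷ leaves Q) (here refl)) b∈E)
  where
  E : Subset _
  E = fromList (b ∷ leaves Q)
  b∈E : b ∈ E
  b∈E = fromList⁺ (b ∷ leaves Q) (here refl)
  b∉Q : b ∉ₗ leaves Q
  b∉Q m = Unique-++-disjoint (uniqueˡ W) (there m) (here refl)
  d∉E : d ∉ E
  d∉E = ∉-fromList-∷ (leaves Q) (λ e → Unique-++-disjoint (uniqueˡ W) (here refl) (here e))
      (Unique-head-∉ (Unique-++⁻ˡ {xs = d ∷ leaves Q} (uniqueˡ W)))
  eqL : restrict E (node (node (leaf d) Q) (leaf b)) ≡ just (node Q (leaf b))
  eqL = trans (restrict-node E (node (leaf d) Q) (leaf b)) (cong₂ join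
    (trans (restrict-node E (leaf d) Q) (cong₂ join (restrict-leaf-∉ E d d∉E) (restrict-⊇ E Q λ z m → fromList⁺ (b ∷ leaves Q) (there m))))
    (restrict-leaf-∈ E b b∈E))
  R₁⊆E : ∀ z → z ∈ₗ leaves R₁ → z ∈ E
  R₁⊆E z m with ⊆ˡ W z (∈-++⁺ˡ m)
  ... | here refl = ⊥-elim (Unique-++-disjoint (uniqueʳ W) m (here refl))
  ... | there m′ = fromList⁺ (b ∷ leaves Q) ([ there , (λ { (here e) → here e }) ]′ (∈-++⁻ (leaves Q) m′))
  eqR : restrict E (node R₁ (leaf d)) ≡ just R₁
  eqR = trans (restrict-node E R₁ (leaf d)) (cong₂ join (restrict-⊇ E R₁ R₁⊆E) (restrict-leaf-∉ E d d∉E))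
  finish : Obstructed (node (node (leaf d) Q) (leaf b)) (node R₁ (leaf d)) ⊎
    Σ[ σ ∈ List (Fin _) ] RestrictedLayout E (node (node (leaf d) Q) (leaf b)) (node R₁ (leaf d)) σ →
    Dichotomy (node (node (leaf d) Q) (leaf b)) (node R₁ (leaf d))
  finish (inj₁ o) = inj₂ o
  finish (inj₂ (_ , r)) with RestrictedLayout-ending E eqL r
  ... | τ , restricted eL eR lL′ lR′ with just-injective (trans (sym eqL) eL) | just-injective (trans (sym eqR) eR)
  ... | refl | refl = inj₁ (d ∷ τ ++ b ∷ [] , node (node leaf (Layout-init b∉Q lL′)) leaf , swap lR′ leaf)

module CrossCherries {n : ℕ} {Q V : Tree n} {b d x y : Fin n}
  (W : SameLeaves (node (node (node (leaf d) (leaf x)) Q) (leaf b)) (node (node (node (leaf b) (leaf y)) V) (leaf d))) where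

  left right : Tree n
  left = node (node (node (leaf d) (leaf x)) Q) (leaf b)
  right = node (node (node (leaf b) (leaf y)) V) (leaf d)

  uL : Unique (d ∷ x ∷ (leaves Q ++ b ∷ []))
  uL = uniqueˡ W
  uR : Unique (b ∷ y ∷ (leaves V ++ d ∷ []))
  uR = uniqueʳ W
  d≢x : d ≢ x
  d≢x e = Unique-head-∉ uL (here e)
  d∉Q : d ∉ₗ leaves Q
  d∉Q m = Unique-head-∉ uL (there (∈-++⁺ˡ m))
  d≢b : d ≢ b
  d≢b e = Unique-head-∉ uL (there (∈-++⁺ʳ (leaves Q) (here e)))
  x∉Q : x ∉ₗ leaves Q
  x∉Q m = Unique-head-∉ (Unique-tail uL) (∈-++⁺ˡ m)
  x≢b : x ≢ b
  x≢b e = Unique-head-∉ (Unique-tail uL) (∈-++⁺ʳ (leaves Q) (here e))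
  b∉Q : b ∉ₗ leaves Q
  b∉Q m = Unique-++-disjoint (Unique-tail (Unique-tail uL)) m (here refl)
  same-obstructed : x ≡ y → Induces T₁ left right
  same-obstructed refl with some-leaf Q
  ... | q , qQ = induces-T₁ (node (leaf d) (leaf x)) Q (node (node (leaf b) (leaf x)) V) (node (leaf b) (leaf x)) b d x q
      uL uR (up here) (here refl) (there (here refl)) qQ (there (here refl)) (here refl) q∈R₁ q∉bx d≢x
    where
    q∈R₁ : q ∈ₗ (b ∷ x ∷ leaves V)
    q∈R₁ with ⊆ʳ W q (there (there (∈-++⁺ˡ qQ)))
    ... | here e = ⊥-elim (b∉Q (∈-resp-≡ e qQ))
    ... | there (here e) = ⊥-elim (x∉Q (∈-resp-≡ e qQ))
    ... | there (there m) = there (there ([ (λ qV → qV) , (λ { (here e) → ⊥-elim (d∉Q (∈-resp-≡ e qQ)) }) ] (∈-++⁻ (leaves V) m)))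
    q∉bx : q ∉ₗ (b ∷ x ∷ [])
    q∉bx (here e) = b∉Q (∈-resp-≡ e qQ)
    q∉bx (there (here e)) = x∉Q (∈-resp-≡ e qQ)
  E : Subset n
  E = fromList (x ∷ leaves Q)
  x∈E : x ∈ E
  x∈E = fromList⁺ (x ∷ leaves Q) (here refl)
  b∉E : b ∉ E
  b∉E = ∉-fromList-∷ (leaves Q) (≢-sym x≢b) b∉Q
  d∉E : d ∉ E
  d∉E = ∉-fromList-∷ (leaves Q) d≢x d∉Q
  classifyL : ∀ {z} → z ∈ₗ leaves left → z ≡ d ⊎ z ≡ x ⊎ z ∈ₗ leaves Q ⊎ z ≡ b
  classifyL (here e) = inj₁ e
  classifyL (there (here e)) = inj₂ (inj₁ e)
  classifyL (there (there m)) = inj₂ (inj₂ (Sum.map₂ (λ { (here e) → e }) (∈-++⁻ (leaves Q) m)))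
  V⊆E : ∀ z → z ∈ₗ leaves V → z ∈ E
  V⊆E z zV with classifyL (⊆ˡ W z (there (there (∈-++⁺ˡ zV))))
  ... | inj₁ e = ⊥-elim (Unique-++-disjoint (Unique-tail (Unique-tail uR)) zV (here e))
  ... | inj₂ (inj₁ e) = fromList⁺ (x ∷ leaves Q) (here e)
  ... | inj₂ (inj₂ (inj₁ zQ)) = fromList⁺ (x ∷ leaves Q) (there zQ)
  ... | inj₂ (inj₂ (inj₂ e)) = ⊥-elim (Unique-head-∉ uR (there (∈-++⁺ˡ (∈-resp-≡ e zV))))
  eqL : restrict E left ≡ just (node (leaf x) Q)
  eqL = trans (restrict-node E (node (node (leaf d) (leaf x)) Q) (leaf b)) (cong₂ join
    (trans (restrict-node E (node (leaf d) (leaf x)) Q) (cong₂ join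
      (trans (restrict-node E (leaf d) (leaf x)) (cong₂ join (restrict-leaf-∉ E d d∉E) (restrict-leaf-∈ E x x∈E)))
      (restrict-⊇ E Q λ z m → fromList⁺ (x ∷ leaves Q) (there m))))
    (restrict-leaf-∉ E b b∉E))
  different-dichotomy : DichotomyFor left right → x ≢ y → Dichotomy left right
  different-dichotomy rec x≢y = finish (restrict-dichotomy rec W E (there (there (∈-++⁺ʳ (leaves Q) (here refl)))) b∉E (there (here refl)) x∈E)
    where
    y∈E : y ∈ E
    y∈E with classifyL (⊆ˡ W y (there (here refl)))
    ... | inj₁ e = ⊥-elim (Unique-head-∉ (Unique-tail uR) (∈-++⁺ʳ (leaves V) (here e)))
    ... | inj₂ (inj₁ e) = ⊥-elim (x≢y (sym e))
    ... | inj₂ (inj₂ (inj₁ yQ)) = fromList⁺ (x ∷ leaves Q) (there yQ)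
    ... | inj₂ (inj₂ (inj₂ e)) = ⊥-elim (Unique-head-∉ uR (here (sym e)))
    eqR : restrict E right ≡ just (node (leaf y) V)
    eqR = trans (restrict-node E (node (node (leaf b) (leaf y)) V) (leaf d)) (cong₂ join
      (trans (restrict-node E (node (leaf b) (leaf y)) V) (cong₂ join
        (trans (restrict-node E (leaf b) (leaf y)) (cong₂ join (restrict-leaf-∉ E b b∉E) (restrict-leaf-∈ E y y∈E)))
        (restrict-⊇ E V V⊆E)))
      (restrict-leaf-∉ E d d∉E))
    finish : Obstructed left right ⊎ Σ[ σ ∈ List (Fin n) ] RestrictedLayout E left right σ → Dichotomy left right
    finish (inj₁ o) = inj₂ o
    finish (inj₂ (_ , r)) with RestrictedLayout-starting E eqL r
    ... | ρ , restricted eL eR lL′ lR′ with just-injective (trans (sym eqL) eL) | just-injective (trans (sym eqR) eR)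
    ... | refl | refl with Layout-node⁻ lR′
    ... | node-layout _ _ leaf _ (inj₁ e) = ⊥-elim (x≢y (proj₁ (∷-injective e)))
    ... | node-layout _ s₂ leaf lV (inj₂ e) = inj₁ (d ∷ x ∷ ρ ++ b ∷ [] ,
          node (node (node leaf leaf) (Layout-tail x∉Q lL′)) leaf ,
          subst (λ l → Layout _ (d ∷ l)) (sym (trans (cong (_++ b ∷ []) e) (++-assoc s₂ (y ∷ []) (b ∷ []))))
              (swap (swap (swap leaf leaf) lV) leaf))

  dichotomy : DichotomyFor left right → Dichotomy left right
  dichotomy rec = [ inj₂ ∘ inj₁ ∘ same-obstructed , different-dichotomy rec ]′ (toSum (x ≟F y))

dichotomy-cross-cherries : (Q V : Tree n) (b d x y : Fin n) →
  DichotomyFor (node (node (node (leaf d) (leaf x)) Q) (leaf b)) (node (node (node (leaf b) (leaf y)) V) (leaf d)) →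
  SameLeaves (node (node (node (leaf d) (leaf x)) Q) (leaf b)) (node (node (node (leaf b) (leaf y)) V) (leaf d)) →
  Dichotomy (node (node (node (leaf d) (leaf x)) Q) (leaf b)) (node (node (node (leaf b) (leaf y)) V) (leaf d))
dichotomy-cross-cherries Q V b d x y rec W = CrossCherries.dichotomy W rec

ThreeLeaves : Tree n → Set
ThreeLeaves {n} t = ∀ (z₁ z₂ : Fin n) → Σ[ w ∈ Fin n ] (w ∈ₗ leaves t × w ≢ z₁ × w ≢ z₂)

node-ThreeLeaves : (a b : Tree n) → Unique (leaves (node a b)) → TwoLeaves a → ThreeLeaves (node a b)
node-ThreeLeaves a b u big z₁ z₂ with big z₁
... | x , xa , x≢z₁ with x ≟F z₂
...   | no x≢z₂ = x , ∈-++⁺ˡ xa , x≢z₁ , x≢z₂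
...   | yes refl with some-leaf b
...     | y , yb with y ≟F z₁
...       | no y≢z₁ = y , ∈-++⁺ʳ (leaves a) yb , y≢z₁ , ≢-sym (Unique-++-≢ u xa yb)
...       | yes refl with big x
...         | x′ , x′a , x′≢x = x′ , ∈-++⁺ˡ x′a , Unique-++-≢ u x′a yb , x′≢x

ThreeLeaves-swap : (a b : Tree n) → ThreeLeaves (node a b) → ThreeLeaves (node b a)
ThreeLeaves-swap a b h z₁ z₂ with h z₁ z₂
... | w , m , w≢z₁ , w≢z₂ = w , ∼-∈ {t = node a b} (swap ∼-refl ∼-refl) m , w≢z₁ , w≢z₂

leaf-other-than : (t : Tree n) (b : Fin n) → Unique (leaves t) → (Σ[ β ∈ Fin n ] (β ∈ₗ leaves t × β ≢ b)) ⊎ t ≡ leaf b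
leaf-other-than (leaf z) b u with z ≟F b
... | yes refl = inj₂ refl
... | no z≢b = inj₁ (z , here refl , z≢b)
leaf-other-than (node a c) b u = inj₁ (node-TwoLeaves a c u b)

module CrossBig {n : ℕ} {P Q R₁ : Tree n} {b d : Fin n}
  (W : SameLeaves (node (node P Q) (leaf b)) (node R₁ (leaf d))) (dP : d ∈ₗ leaves P) where

  left right : Tree n
  left = node (node P Q) (leaf b)
  right = node R₁ (leaf d)

  uPQ : Unique (leaves P ++ leaves Q)
  uPQ = Unique-++⁻ˡ (uniqueˡ W)

  uR₁ : Unique (leaves R₁)
  uR₁ = Unique-++⁻ˡ (uniqueʳ W)

  P∩Q : ∀ {z} → z ∈ₗ leaves P → z ∈ₗ leaves Q → ⊥
  P∩Q = Unique-++-disjoint {xs = leaves P} uPQ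

  b∉PQ : b ∉ₗ leaves P ++ leaves Q
  b∉PQ m = Unique-++-disjoint (uniqueˡ W) m (here refl)

  d≢R₁ : ∀ {z} → z ∈ₗ leaves R₁ → d ≢ z
  d≢R₁ m refl = Unique-++-disjoint (uniqueʳ W) m (here refl)

  d≢b : d ≢ b
  d≢b e = b∉PQ (∈-++⁺ˡ (∈-resp-≡ e dP))

  b∈left : b ∈ₗ leaves left
  b∈left = ∈-++⁺ʳ (leaves P ++ leaves Q) (here refl)

  X : Subset n
  X = fromList (leaves P)

  ∈R₁ : ∀ {z} → z ∈ₗ leaves left → z ≢ d → z ∈ₗ leaves R₁
  ∈R₁ {z} m z≢d = [ (λ zR₁ → zR₁) , (λ { (here e) → ⊥-elim (z≢d e) }) ]′ (∈-++⁻ (leaves R₁) (⊆ʳ W z m))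

  R₁-∉X : ∀ {z} → z ∈ₗ leaves R₁ → z ∉ X → z ∈ₗ leaves Q ⊎ z ≡ b
  R₁-∉X {z} m z∉X with ∈-++⁻ (leaves P ++ leaves Q) (⊆ˡ W z (∈-++⁺ˡ m))
  ... | inj₂ (here e) = inj₂ e
  ... | inj₁ mPQ = [ (λ zP → ⊥-elim (z∉X (fromList⁺ (leaves P) zP))) , inj₁ ]′ (∈-++⁻ (leaves P) mPQ)

  R₁-straddles : ThreeLeaves P → Straddles X R₁
  R₁-straddles big with big d d
  ... | w , wP , w≢d , _ = (w , ∈R₁ (∈-++⁺ˡ (∈-++⁺ˡ wP)) w≢d , fromList⁺ (leaves P) wP) ,
    (b , ∈R₁ b∈left (≢-sym d≢b) , λ bX → b∉PQ (∈-++⁺ˡ (fromList⁻ (leaves P) bX)))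

  siblings-obstructed : (r₁ r₂ : Tree n) → Subtree (node r₁ r₂) R₁ → (x₁ y₁ x₂ y₂ : Fin n) →
    x₁ ∈ₗ leaves r₁ → y₁ ∈ₗ leaves r₁ → x₂ ∈ₗ leaves r₂ → y₂ ∈ₗ leaves r₂ → x₁ ∈ X → y₁ ∉ X → x₂ ∈ X → y₂ ∉ X →
    Obstructed left right
  siblings-obstructed r₁ r₂ sb x₁ y₁ x₂ y₂ mx₁ my₁ mx₂ my₂ px₁ py₁ px₂ py₂
    with R₁-∉X (Subtree-∈ sb (∈-++⁺ˡ my₁)) py₁ | R₁-∉X (Subtree-∈ sb (∈-++⁺ʳ (leaves r₁) my₂)) py₂
  ... | inj₂ e₁ | inj₂ e₂ = ⊥-elim (Unique-++-disjoint (Subtree-unique sb uR₁) my₁ (∈-resp-≡ (trans e₂ (sym e₁)) my₂))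
  ... | inj₂ e₁ | inj₁ y₂Q = inj₁ (induces-T₁ P Q R₁ r₁ b d x₁ y₂ (uniqueˡ W) (uniqueʳ W) (Subtree-trans (up here) sb) dP
    (fromList⁻ (leaves P) px₁) y₂Q mx₁ (∈-resp-≡ e₁ my₁) (Subtree-∈ sb (∈-++⁺ʳ (leaves r₁) my₂))
    (λ m → Unique-++-disjoint (Subtree-unique sb uR₁) m my₂) (d≢R₁ (Subtree-∈ sb (∈-++⁺ˡ mx₁))))
  ... | inj₁ y₁Q | inj₂ e₂ = inj₁ (induces-T₁ P Q R₁ r₂ b d x₂ y₁ (uniqueˡ W) (uniqueʳ W) (Subtree-trans (down here) sb) dP
    (fromList⁻ (leaves P) px₂) y₁Q mx₂ (∈-resp-≡ e₂ my₂) (Subtree-∈ sb (∈-++⁺ˡ my₁))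
    (Unique-++-disjoint (Subtree-unique sb uR₁) my₁) (d≢R₁ (Subtree-∈ sb (∈-++⁺ʳ (leaves r₁) mx₂))))
  ... | inj₁ y₁Q | inj₁ y₂Q = inj₂ (induces-T₂ {L′ = left} {right} P Q r₁ r₂ (up here) (up sb) (uniqueˡ W) (uniqueʳ W) x₁ x₂ y₁ y₂
    (fromList⁻ (leaves P) px₁) (fromList⁻ (leaves P) px₂) y₁Q y₂Q mx₁ my₁ mx₂ my₂)

  pendant-obstructed : (w rᵢ : Tree n) → Subtree w R₁ → Children w rᵢ (leaf b) → LeavesIn X rᵢ →
    (α : Fin n) → α ∈ₗ leaves rᵢ → Induces T₁ left right
  pendant-obstructed w rᵢ sb ch i α αᵢ with some-leaf Q
  ... | q , qQ = induces-T₁ P Q R₁ w b d α q (uniqueˡ W) (uniqueʳ W) sb dP (fromList⁻ (leaves P) (i α αᵢ)) qQ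
    (Children-∈ˡ ch αᵢ) (Children-∈ʳ ch (here refl)) (∈R₁ (∈-++⁺ˡ (∈-++⁺ʳ (leaves P) qQ)) (λ e → P∩Q (∈-resp-≡ (sym e) dP) qQ))
    (λ m → [ (λ qᵢ → P∩Q (fromList⁻ (leaves P) (i q qᵢ)) qQ) , (λ { (here e) → b∉PQ (∈-++⁺ʳ (leaves P) (∈-resp-≡ e qQ)) }) ]′ (Children-∈⁻ ch m))
    (d≢R₁ (Subtree-∈ sb (Children-∈ˡ ch αᵢ)))

  EX : Fin n → Subset n
  EX β = fromList (β ∷ leaves P)

  EY : Fin n → Subset n
  EY α = fromList (α ∷ b ∷ leaves Q)

  -- Keeping d as well pins α next to d, an end of every layout of right (cherry-first-layout).
  EY⁺ : Fin n → Subset n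
  EY⁺ α = fromList (d ∷ α ∷ b ∷ leaves Q)

  P∩bQ : ∀ {z} → z ∈ₗ leaves P → z ∈ₗ (b ∷ leaves Q) → ⊥
  P∩bQ zP (here e) = b∉PQ (∈-++⁺ˡ (∈-resp-≡ e zP))
  P∩bQ zP (there m) = P∩Q zP m

  left-cover : ∀ {z} → z ∈ₗ leaves left → z ∈ₗ leaves P ⊎ z ∈ₗ (b ∷ leaves Q)
  left-cover m with ∈-++⁻ (leaves P ++ leaves Q) m
  ... | inj₁ mPQ = Sum.map₂ there (∈-++⁻ (leaves P) mPQ)
  ... | inj₂ (here e) = inj₂ (here e)

  setting : {α β : Fin n} (t : Tree n) → (∀ {z} → z ∈ₗ leaves t → z ∈ₗ leaves left) → α ∈ₗ leaves P → β ∈ₗ leaves Q →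
    GlueSetting X (EX β) (EY α) α β t
  setting t t⊆left αP βQ = fromList-GlueSetting (leaves P) (b ∷ leaves Q) t αP (there βQ) P∩bQ (left-cover ∘ t⊆left)

  b∉EX : {β : Fin n} → β ∈ₗ leaves Q → b ∉ EX β
  b∉EX βQ = ∉-fromList-∷ (leaves P) (λ e → b∉PQ (∈-++⁺ʳ (leaves P) (∈-resp-≡ (sym e) βQ))) (λ bP → b∉PQ (∈-++⁺ˡ bP))

  restrictX-left : {β : Fin n} → β ∈ₗ leaves Q → restrict (EX β) left ≡ just (node P (leaf β))
  restrictX-left {β} βQ = trans (restrict-node (EX β) (node P Q) (leaf b))
    (cong₂ join (restrict-up-and-leaf P Q uPQ βQ) (restrict-leaf-∉ (EX β) b (b∉EX βQ)))

  restrictY⁺-left : {α : Fin n} → α ∈ₗ leaves P → d ≢ α → restrict (EY⁺ α) left ⇝ node (node (node (leaf d) (leaf α)) Q) (leaf b)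
  restrictY⁺-left {α} αP d≢α = ⇝-node E (node P Q) (leaf b)
    (⇝-node E P Q
      (restrict-cherry E P d α (Unique-++⁻ˡ {xs = leaves P} uPQ) d≢α dP αP (∈E (here refl)) (∈E (there (here refl)))
        (HitsOnly-narrow (fromList-HitsOnly (d ∷ α ∷ b ∷ leaves Q)) λ { (here refl) _ → here refl ; (there (here refl)) _ → there (here refl)
          ; (there (there (here refl))) bP → ⊥-elim (b∉PQ (∈-++⁺ˡ bP)) ; (there (there (there zQ))) zP → ⊥-elim (P∩Q zP zQ) }))
      (Q , restrict-⊇ E Q (λ z m → ∈E (there (there (there m)))) , ∼-refl))
    (⇝-leaf E b (∈E (there (there (here refl)))))
    where
    E : Subset n
    E = EY⁺ α
    ∈E : ∀ {z} → z ∈ₗ (d ∷ α ∷ b ∷ leaves Q) → z ∈ E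
    ∈E = fromList⁺ (d ∷ α ∷ b ∷ leaves Q)

  restrictY⁺-right : {α : Fin n} → α ∈ₗ leaves R₁ → Σ[ RY ∈ Tree n ] restrict (EY⁺ α) right ≡ just (node RY (leaf d))
  restrictY⁺-right {α} αR₁ with restrict-just (EY⁺ α) R₁ αR₁ (fromList⁺ (d ∷ α ∷ b ∷ leaves Q) (there (here refl)))
  ... | RY , eRY = RY , trans (restrict-node (EY⁺ α) R₁ (leaf d))
    (cong₂ join eRY (restrict-leaf-∈ (EY⁺ α) d (fromList⁺ (d ∷ α ∷ b ∷ leaves Q) (here refl))))

  drop-d : {α : Fin n} (t : Tree n) {t′ tY : Tree n} {ρ : List (Fin n)} → α ∈ₗ leaves R₁ → restrict (EY⁺ α) t ≡ just t′ →
    Layout t′ (d ∷ α ∷ ρ) → restrict (EY α) t ≡ just tY → Layout tY (α ∷ keep (EY α) ρ)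
  drop-d {α} t {t′} {ρ = ρ} αR₁ e l eY = subst (Layout _) (keep-∉∷∈∷ (EY α) d α ρ d∉EY (fromList⁺ (α ∷ b ∷ leaves Q) (here refl)))
    (Layout-restrict (EY α) l
        (trans (restrict-restrict (EY⁺ α) (EY α) t t′ e λ z _ m → fromList⁺ (d ∷ α ∷ b ∷ leaves Q) (there (fromList⁻ (α ∷ b ∷ leaves Q) m))) eY))
    where
    d∉EY : d ∉ EY α
    d∉EY = ∉-fromList-∷ (b ∷ leaves Q) (d≢R₁ αR₁) λ { (here e) → d≢b e ; (there dQ) → P∩Q dP dQ }

  starting-with-α : {α : Fin n} {σ : List (Fin n)} → α ∈ₗ leaves P → α ∈ₗ leaves R₁ →
    RestrictedLayout (EY⁺ α) left right σ → Σ[ υ ∈ List (Fin n) ] RestrictedLayout (EY α) left right (α ∷ υ)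
  starting-with-α {α} αP αR₁ (restricted eL eR lL lR) with restrictY⁺-left αP (d≢R₁ αR₁) | restrictY⁺-right αR₁
  ... | t₀ , e₀ , p₀ | RY , eRY with just-injective (trans (sym e₀) eL) | just-injective (trans (sym eRY) eR)
  ... | refl | refl with cherry-first-layout (Layout-resp-∼ (∼-sym p₀) lL) lR d≢b (d≢R₁ αR₁) (P∩Q dP)
  ... | ρ , lPat , lR′ with restrict-just (EY α) left (∈-++⁺ˡ (∈-++⁺ˡ αP)) (fromList⁺ (α ∷ b ∷ leaves Q) (here refl))
                           | restrict-just (EY α) right (∈-++⁺ˡ αR₁) (fromList⁺ (α ∷ b ∷ leaves Q) (here refl))
  ... | _ , eYL | _ , eYR = keep (EY α) ρ , restricted eYL eYR (drop-d left αR₁ eL (Layout-resp-∼ p₀ lPat) eYL) (drop-d right αR₁ eR lR′ eYR)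

  glue-case : DichotomyFor left right → ThreeLeaves P → (α β : Fin n) → α ∈ₗ leaves P → α ∈ₗ leaves R₁ →
    β ∈ₗ leaves Q → β ∈ₗ leaves R₁ → StraddlesOnlyAbove X α β R₁ → Dichotomy left right
  glue-case rec big α β αP αR₁ βQ βR₁ aboveR₁ =
    combine (restrict-dichotomy rec W (EX β) b∈left (b∉EX βQ) βL (fromList⁺ (β ∷ leaves P) (here refl)))
            (restrict-dichotomy rec W (EY⁺ α) (∈-++⁺ˡ (∈-++⁺ˡ wP)) w∉EY⁺ b∈left (fromList⁺ (d ∷ α ∷ b ∷ leaves Q) (there (there (here refl)))))
    where
    αL : α ∈ₗ leaves left
    αL = ∈-++⁺ˡ (∈-++⁺ˡ αP)
    βL : β ∈ₗ leaves left
    βL = ∈-++⁺ˡ (∈-++⁺ʳ (leaves P) βQ)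
    w : Fin n
    w = proj₁ (big d α)
    wP : w ∈ₗ leaves P
    wP = proj₁ (proj₂ (big d α))
    w∉EY⁺ : w ∉ EY⁺ α
    w∉EY⁺ = ∉-fromList-∷ (α ∷ b ∷ leaves Q) (proj₁ (proj₂ (proj₂ (big d α)))) λ
      { (here e) → proj₂ (proj₂ (proj₂ (big d α))) e ; (there (here e)) → b∉PQ (∈-++⁺ˡ (∈-resp-≡ e wP)) ; (there (there m)) → P∩Q wP m }
    aboveL : StraddlesOnlyAbove X α β left
    aboveL = inj₁ (αL , βL) , (inj₁ (∈-++⁺ˡ αP , ∈-++⁺ʳ (leaves P) βQ) , LeavesIn⇒StraddlesOnlyAbove P (λ _ → fromList⁺ (leaves P)) ,
             LeavesOut⇒StraddlesOnlyAbove Q (λ _ m zX → P∩Q (fromList⁻ (leaves P) zX) m)) , tt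
    combine : Obstructed left right ⊎ Σ[ σ ∈ List (Fin n) ] RestrictedLayout (EX β) left right σ →
              Obstructed left right ⊎ Σ[ σ ∈ List (Fin n) ] RestrictedLayout (EY⁺ α) left right σ → Dichotomy left right
    combine (inj₁ o) _ = inj₂ o
    combine (inj₂ _) (inj₁ o) = inj₂ o
    combine (inj₂ (_ , rX)) (inj₂ (_ , rY⁺)) with RestrictedLayout-ending (EX β) (restrictX-left βQ) rX | starting-with-α αP αR₁ rY⁺
    ... | τ , rX′ | υ , rY = inj₁ (glue-common-layouts (setting left (λ m → m) αP βQ) (setting right (⊆ˡ W _) αP βQ)
          aboveL (inj₁ (∈-++⁺ˡ αR₁ , ∈-++⁺ˡ βR₁) , aboveR₁ , tt) W αL βL τ υ rX′ rY)

  dichotomy-cross-big : DichotomyFor left right → ThreeLeaves P → Dichotomy left right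
  dichotomy-cross-big rec big with straddle-shape X R₁ (R₁-straddles big)
  ... | straddling-siblings r₁ r₂ sb x₁ y₁ x₂ y₂ mx₁ my₁ mx₂ my₂ px₁ py₁ px₂ py₂ =
    inj₂ (siblings-obstructed r₁ r₂ sb x₁ y₁ x₂ y₂ mx₁ my₁ mx₂ my₂ px₁ py₁ px₂ py₂)
  ... | separating-vertex w rᵢ rₒ sb ch i o above with some-leaf rᵢ | leaf-other-than rₒ b (Children-unique ch (Subtree-unique sb uR₁))
  ...   | α , αᵢ | inj₂ refl = inj₂ (inj₁ (pendant-obstructed w rᵢ sb ch i α αᵢ))
  ...   | α , αᵢ | inj₁ (β , βₒ , β≢b) =
    glue-case rec big α β (fromList⁻ (leaves P) (i α αᵢ)) (Subtree-∈ sb (Children-∈ˡ ch αᵢ))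
      ([ (λ βQ → βQ) , (λ e → ⊥-elim (β≢b e)) ]′ (R₁-∉X βR₁ (o β βₒ))) βR₁ (above α β αᵢ βₒ)
    where
    βR₁ : β ∈ₗ leaves R₁
    βR₁ = Subtree-∈ sb (Children-∈ʳ ch βₒ)

open CrossBig using (dichotomy-cross-big)

by-symmetry : {L′ R′ : Tree n} → DichotomyFor L′ R′ → SameLeaves L′ R′ →
  (DichotomyFor R′ L′ → SameLeaves R′ L′ → Dichotomy R′ L′) → Dichotomy L′ R′
by-symmetry {L′ = L′} {R′} rec W k = Dichotomy-swap (k (DichotomyFor-swap L′ R′ rec) (SameLeaves-swap W))

node-ThreeLeavesʳ : (a b : Tree n) → Unique (leaves (node a b)) → TwoLeaves b → ThreeLeaves (node a b)
node-ThreeLeavesʳ a b u big =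
  ThreeLeaves-swap b a (node-ThreeLeaves b a (Layout-unique (∼⇒Layout {t = node a b} (swap ∼-refl ∼-refl)) u) big)

dichotomy-cross : (P Q U V : Tree n) (b d : Fin n) → d ∈ₗ leaves P → b ∈ₗ leaves U →
  DichotomyFor (node (node P Q) (leaf b)) (node (node U V) (leaf d)) →
  SameLeaves (node (node P Q) (leaf b)) (node (node U V) (leaf d)) → Dichotomy (node (node P Q) (leaf b)) (node (node U V) (leaf d))
dichotomy-cross (leaf _) Q U V b d (here refl) bU rec W = dichotomy-cross-pendant-leaf Q (node U V) b d rec W
dichotomy-cross P Q (leaf _) V b d dP (here refl) rec W = by-symmetry rec W (dichotomy-cross-pendant-leaf V (node P Q) d b)
dichotomy-cross (node (node a c) e) Q U V b d dP bU rec W = dichotomy-cross-big W dP rec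
  (node-ThreeLeaves (node a c) e uP (node-TwoLeaves a c (Unique-++⁻ˡ uP)))
  where
  uP : Unique (leaves (node (node a c) e))
  uP = Unique-++⁻ˡ (Unique-++⁻ˡ (uniqueˡ W))
dichotomy-cross (node (leaf a) (node c e)) Q U V b d dP bU rec W = dichotomy-cross-big W dP rec
  (node-ThreeLeavesʳ (leaf a) (node c e) uP (node-TwoLeaves c e (Unique-tail uP)))
  where
  uP : Unique (leaves (node (leaf a) (node c e)))
  uP = Unique-++⁻ˡ (Unique-++⁻ˡ (uniqueˡ W))
dichotomy-cross P Q (node (node a c) e) V b d dP bU rec W = by-symmetry rec W λ rec′ W′ → dichotomy-cross-big W′ bU rec′
  (node-ThreeLeaves (node a c) e uU (node-TwoLeaves a c (Unique-++⁻ˡ uU)))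
  where
  uU : Unique (leaves (node (node a c) e))
  uU = Unique-++⁻ˡ (Unique-++⁻ˡ (uniqueʳ W))
dichotomy-cross P Q (node (leaf a) (node c e)) V b d dP bU rec W = by-symmetry rec W λ rec′ W′ → dichotomy-cross-big W′ bU rec′
  (node-ThreeLeavesʳ (leaf a) (node c e) uU (node-TwoLeaves c e (Unique-tail uU)))
  where
  uU : Unique (leaves (node (leaf a) (node c e)))
  uU = Unique-++⁻ˡ (Unique-++⁻ˡ (uniqueʳ W))
dichotomy-cross (node (leaf _) (leaf x)) Q (node (leaf _) (leaf y)) V b d (here refl) (here refl) rec W =
  dichotomy-cross-cherries Q V b d x y rec W
dichotomy-cross (node (leaf x) (leaf _)) Q (node (leaf _) (leaf y)) V b d (there (here refl)) (here refl) rec W =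
  dichotomy-via-∼ (node (node (swap leaf leaf) ∼-refl) leaf) ∼-refl rec W (dichotomy-cross-cherries Q V b d x y)
dichotomy-cross (node (leaf _) (leaf x)) Q (node (leaf y) (leaf _)) V b d (here refl) (there (here refl)) rec W =
  dichotomy-via-∼ ∼-refl (node (node (swap leaf leaf) ∼-refl) leaf) rec W (dichotomy-cross-cherries Q V b d x y)
dichotomy-cross (node (leaf x) (leaf _)) Q (node (leaf y) (leaf _)) V b d (there (here refl)) (there (here refl)) rec W =
  dichotomy-via-∼ (node (node (swap leaf leaf) ∼-refl) leaf) (node (node (swap leaf leaf) ∼-refl) leaf) rec W
    (dichotomy-cross-cherries Q V b d x y)

-- R₁ cannot be a single leaf, as the left tree has at least three leaves.
dichotomy-cross-in-up : (P Q R₁ : Tree n) (b d : Fin n) → b ≢ d → d ∈ₗ leaves P →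
  DichotomyFor (node (node P Q) (leaf b)) (node R₁ (leaf d)) → SameLeaves (node (node P Q) (leaf b)) (node R₁ (leaf d)) →
  Dichotomy (node (node P Q) (leaf b)) (node R₁ (leaf d))
dichotomy-cross-in-up P Q (leaf z) b d b≢d dP rec W with some-leaf P | some-leaf Q | ⊆ʳ W b (∈-++⁺ʳ (leaves P ++ leaves Q) (here refl))
... | p , pP | q , qQ | there (here b≡d) = ⊥-elim (b≢d b≡d)
... | p , pP | q , qQ | here refl = ⊥-elim
    (Unique-++-≢ (Unique-++⁻ˡ (uniqueˡ W)) pP qQ (trans (≡d (∈-++⁺ˡ pP)) (sym (≡d (∈-++⁺ʳ (leaves P) qQ)))))
  where
  ≡d : ∀ {w} → w ∈ₗ leaves P ++ leaves Q → w ≡ d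
  ≡d {w} m with ⊆ʳ W w (∈-++⁺ˡ m)
  ... | here refl = ⊥-elim (Unique-++-disjoint (uniqueˡ W) m (here refl))
  ... | there (here e) = e
dichotomy-cross-in-up P Q (node U V) b d b≢d dP rec W
  with ∈-++⁻ (leaves U ++ leaves V) (⊆ʳ W b (∈-++⁺ʳ (leaves P ++ leaves Q) (here refl)))
... | inj₂ (here b≡d) = ⊥-elim (b≢d b≡d)
... | inj₁ bUV with ∈-++⁻ (leaves U) bUV
...   | inj₁ bU = dichotomy-cross P Q U V b d dP bU rec W
...   | inj₂ bV = dichotomy-via-∼ ∼-refl (node (swap ∼-refl ∼-refl) leaf) rec W (dichotomy-cross P Q V U b d dP bV)

dichotomy-distinct-pendants-up : (P Q R₁ : Tree n) (b d : Fin n) → b ≢ d →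
  DichotomyFor (node (node P Q) (leaf b)) (node R₁ (leaf d)) → SameLeaves (node (node P Q) (leaf b)) (node R₁ (leaf d)) →
  Dichotomy (node (node P Q) (leaf b)) (node R₁ (leaf d))
dichotomy-distinct-pendants-up P Q R₁ b d b≢d rec W with ∈-++⁻ (leaves P ++ leaves Q) (⊆ˡ W d (∈-++⁺ʳ (leaves R₁) (here refl)))
... | inj₂ (here d≡b) = ⊥-elim (b≢d (sym d≡b))
... | inj₁ dPQ with ∈-++⁻ (leaves P) dPQ
...   | inj₁ dP = dichotomy-cross-in-up P Q R₁ b d b≢d dP rec W
...   | inj₂ dQ = dichotomy-via-∼ (node (swap ∼-refl ∼-refl) leaf) ∼-refl rec W (dichotomy-cross-in-up Q P R₁ b d b≢d dQ)

dichotomy-distinct-pendants : (L₁ R₁ : Tree n) (b d : Fin n) → b ≢ d →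
  DichotomyFor (node L₁ (leaf b)) (node R₁ (leaf d)) → SameLeaves (node L₁ (leaf b)) (node R₁ (leaf d)) →
  Dichotomy (node L₁ (leaf b)) (node R₁ (leaf d))
dichotomy-distinct-pendants (node P Q) R₁ b d b≢d rec W = dichotomy-distinct-pendants-up P Q R₁ b d b≢d rec W
dichotomy-distinct-pendants (leaf z) (node U V) b d b≢d rec W =
  by-symmetry rec W (dichotomy-distinct-pendants-up U V (leaf z) d b (≢-sym b≢d))
dichotomy-distinct-pendants (leaf z) (leaf z′) b d b≢d rec W with ⊆ˡ W d (there (here refl)) | ⊆ˡ W z′ (here refl)
... | there (here d≡b) | _ = ⊥-elim (b≢d (sym d≡b))
... | here refl | here refl = ⊥-elim (Unique-head-∉ (uniqueʳ W) (here refl))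
... | here refl | there (here refl) = inj₁ (d ∷ b ∷ [] , node leaf leaf , swap leaf leaf)

dichotomy-equal-pendants : (L₁ R₁ : Tree n) (b : Fin n) → DichotomyFor (node L₁ (leaf b)) (node R₁ (leaf b)) →
  SameLeaves (node L₁ (leaf b)) (node R₁ (leaf b)) → Dichotomy (node L₁ (leaf b)) (node R₁ (leaf b))
dichotomy-equal-pendants L₁ R₁ b rec W =
  finish (restrict-dichotomy rec W E (∈-++⁺ʳ (leaves L₁) (here refl)) b∉E (∈-++⁺ˡ (proj₂ (some-leaf L₁)))
      (fromList⁺ (leaves L₁) (proj₂ (some-leaf L₁))))
  where
  E : Subset _
  E = fromList (leaves L₁)
  b∉E : b ∉ E
  b∉E m = Unique-++-disjoint (uniqueˡ W) (fromList⁻ (leaves L₁) m) (here refl)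
  eqL : restrict E (node L₁ (leaf b)) ≡ just L₁
  eqL = trans (restrict-node E L₁ (leaf b)) (cong₂ join (restrict-⊇ E L₁ (λ z → fromList⁺ (leaves L₁))) (restrict-leaf-∉ E b b∉E))
  R₁⊆E : ∀ z → z ∈ₗ leaves R₁ → z ∈ E
  R₁⊆E z m with ∈-++⁻ (leaves L₁) (⊆ˡ W z (∈-++⁺ˡ m))
  ... | inj₁ zL₁ = fromList⁺ (leaves L₁) zL₁
  ... | inj₂ (here refl) = ⊥-elim (Unique-++-disjoint (uniqueʳ W) m (here refl))
  eqR : restrict E (node R₁ (leaf b)) ≡ just R₁
  eqR = trans (restrict-node E R₁ (leaf b)) (cong₂ join (restrict-⊇ E R₁ R₁⊆E) (restrict-leaf-∉ E b b∉E))
  finish : Obstructed (node L₁ (leaf b)) (node R₁ (leaf b)) ⊎ Σ[ σ ∈ List (Fin _) ] RestrictedLayout E (node L₁ (leaf b)) (node R₁ (leaf b)) σ →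
    Dichotomy (node L₁ (leaf b)) (node R₁ (leaf b))
  finish (inj₁ o) = inj₂ o
  finish (inj₂ (σ , restricted eL eR lL lR)) with just-injective (trans (sym eqL) eL) | just-injective (trans (sym eqR) eR)
  ... | refl | refl = inj₁ (σ ++ b ∷ [] , node lL leaf , node lR leaf)

dichotomy-pendants : (L₁ R₁ : Tree n) (b d : Fin n) → DichotomyFor (node L₁ (leaf b)) (node R₁ (leaf d)) →
  SameLeaves (node L₁ (leaf b)) (node R₁ (leaf d)) → Dichotomy (node L₁ (leaf b)) (node R₁ (leaf d))
dichotomy-pendants L₁ R₁ b d rec W with b ≟F d
... | yes refl = dichotomy-equal-pendants L₁ R₁ b rec W
... | no b≢d = dichotomy-distinct-pendants L₁ R₁ b d b≢d rec W

pendant-or-two-big : (u v : Tree n) → (Σ[ t ∈ Tree n ] Σ[ b ∈ Fin n ] (node u v ∼ node t (leaf b))) ⊎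
  (Σ[ a ∈ Tree n ] Σ[ c ∈ Tree n ] Σ[ e ∈ Tree n ] Σ[ f ∈ Tree n ] (u ≡ node a c × v ≡ node e f))
pendant-or-two-big u (leaf b) = inj₁ (u , b , ∼-refl)
pendant-or-two-big (leaf b) (node a c) = inj₁ (node a c , b , swap ∼-refl ∼-refl)
pendant-or-two-big (node a c) (node e f) = inj₂ (a , c , e , f , refl , refl)

single-leaf : {x : Fin n} {u v : Tree n} → SameLeaves (leaf x) (node u v) → ⊥
single-leaf {u = u} {v} W with some-leaf u | some-leaf v
... | y , yu | z , zv with ⊆ˡ W y (∈-++⁺ˡ yu) | ⊆ˡ W z (∈-++⁺ʳ (leaves u) zv)
... | here refl | here refl = Unique-++-disjoint (uniqueʳ W) yu zv

dichotomy-step : (L′ R′ : Tree n) → DichotomyFor L′ R′ → SameLeaves L′ R′ → Dichotomy L′ R′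
dichotomy-step (leaf x) (leaf y) rec W with ⊆ˡ W y (here refl)
... | here refl = inj₁ (x ∷ [] , leaf , leaf)
dichotomy-step (leaf x) (node u v) rec W = ⊥-elim (single-leaf W)
dichotomy-step (node u v) (leaf y) rec W = ⊥-elim (single-leaf (SameLeaves-swap W))
dichotomy-step (node L₁ L₂) (node R₁ R₂) rec W with pendant-or-two-big L₁ L₂ | pendant-or-two-big R₁ R₂
... | inj₂ (a , c , e , f , refl , refl) | _ = dichotomy-two-big-children (node a c) (node e f) (node R₁ R₂) rec W
  (node-TwoLeaves a c (Unique-++⁻ˡ (uniqueˡ W))) (node-TwoLeaves e f (Unique-++⁻ʳ {xs = leaves (node a c)} (uniqueˡ W)))
... | inj₁ _ | inj₂ (a , c , e , f , refl , refl) = by-symmetry rec W λ rec′ W′ →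
  dichotomy-two-big-children (node a c) (node e f) (node L₁ L₂) rec′ W′
    (node-TwoLeaves a c (Unique-++⁻ˡ (uniqueʳ W))) (node-TwoLeaves e f (Unique-++⁻ʳ {xs = leaves (node a c)} (uniqueʳ W)))
... | inj₁ (L₁′ , b , pL) | inj₁ (R₁′ , d , pR) = dichotomy-via-∼ pL pR rec W (dichotomy-pendants L₁′ R₁′ b d)

dichotomy-bounded : (k : ℕ) (L′ R′ : Tree n) → size L′ + size R′ < k → SameLeaves L′ R′ → Dichotomy L′ R′
dichotomy-bounded zero L′ R′ () W
dichotomy-bounded (suc k) L′ R′ lt W = dichotomy-step L′ R′ (λ L″ R″ lt′ W′ → dichotomy-bounded k L″ R″ (<-≤-trans lt′ (≤-pred lt)) W′) W

dichotomy : {L′ R′ : Tree n} → SameLeaves L′ R′ → Dichotomy L′ R′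
dichotomy {L′ = L′} {R′} = dichotomy-bounded (suc (size L′ + size R′)) L′ R′ ≤-refl

-- Planarity and crossing-critical tanglegrams

map-resp-∼ : {B : Set} (g : A → B) {t s : BT A} → t ∼ s → map g t ∼ map g s
map-resp-∼ g leaf = leaf
map-resp-∼ g (node p q) = node (map-resp-∼ g p) (map-resp-∼ g q)
map-resp-∼ g (swap p q) = swap (map-resp-∼ g p) (map-resp-∼ g q)

map-∼⁻ : {B : Set} (f : A → B) (t : BT A) {s : BT B} → map f t ∼ s → Σ[ t′ ∈ BT A ] (t ∼ t′ × map f t′ ≡ s)
map-∼⁻ f (leaf x) leaf = leaf x , ∼-refl , refl
map-∼⁻ f (node u d) (node p q) with map-∼⁻ f u p | map-∼⁻ f d q
... | u′ , pu , refl | d′ , pd , refl = node u′ d′ , node pu pd , refl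
map-∼⁻ f (node u d) (swap p q) with map-∼⁻ f u p | map-∼⁻ f d q
... | u′ , pu , refl | d′ , pd , refl = node d′ u′ , swap pu pd , refl

map-inverse : {B : Set} (g : B → A) (f : A → B) → (∀ x → g (f x) ≡ x) → (t : BT A) → map g (map f t) ≡ t
map-inverse g f h t = trans (map-∘ g f t) (map-id t)
  where
  map-id : (t : BT _) → map (g ∘ f) t ≡ t
  map-id (leaf x) = cong leaf (h x)
  map-id (node u d) = cong₂ node (map-id u) (map-id d)

Before-map⁺ : {B : Set} (f : A → B) {i j : A} {xs : List A} → Before i j xs → Before (f i) (f j) (lmap f xs)
Before-map⁺ f (here m) = here (∈-map⁺ f m)
Before-map⁺ f (there b) = there (Before-map⁺ f b)

Before-map⁻ : {B : Set} (f : A → B) {i j : B} (xs : List A) → Before i j (lmap f xs) →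
  Σ[ i′ ∈ A ] Σ[ j′ ∈ A ] (f i′ ≡ i × f j′ ≡ j × Before i′ j′ xs)
Before-map⁻ f (x ∷ xs) (here m) with ∈-map⁻ f m
... | j′ , mj , e = x , j′ , refl , sym e , here mj
Before-map⁻ f (x ∷ xs) (there b) with Before-map⁻ f xs b
... | i′ , j′ , e₁ , e₂ , b′ = i′ , j′ , e₁ , e₂ , there b′

PlanarPair-resp-∼ : {L₁ L₂ R₁ R₂ : BT A} → L₁ ∼ L₂ → R₁ ∼ R₂ → PlanarPair L₁ R₁ → PlanarPair L₂ R₂
PlanarPair-resp-∼ pL pR (L′ , R′ , qL , qR , nc) = L′ , R′ , ∼-trans (∼-sym pL) qL , ∼-trans (∼-sym pR) qR , nc

PlanarPair-map⁻ : {B : Set} (f : A → B) {L₁ R₁ : BT A} → PlanarPair (map f L₁) (map f R₁) → PlanarPair L₁ R₁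
PlanarPair-map⁻ f {L₁} {R₁} (L′ , R′ , qL , qR , nc) with map-∼⁻ f L₁ qL | map-∼⁻ f R₁ qR
... | L″ , pL , refl | R″ , pR , refl = L″ , R″ , pL , pR , λ i j (c₁ , c₂) →
  nc (f i) (f j) (subst (Before (f i) (f j)) (sym (leaves-map f L″)) (Before-map⁺ f c₁)
                 , subst (Before (f j) (f i)) (sym (leaves-map f R″)) (Before-map⁺ f c₂))

PlanarPair-map : {B : Set} (g : A → B) → Injective _≡_ _≡_ g → {L₁ R₁ : BT A} → PlanarPair L₁ R₁ → PlanarPair (map g L₁) (map g R₁)
PlanarPair-map g inj (L′ , R′ , qL , qR , nc) = map g L′ , map g R′ , map-resp-∼ g qL , map-resp-∼ g qR , no-crossing
  where
  no-crossing : ∀ i j → ¬ Crosses (map g L′) (map g R′) i j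
  no-crossing i j (c₁ , c₂) with Before-map⁻ g (leaves L′) (subst (Before i j) (leaves-map g L′) c₁)
                               | Before-map⁻ g (leaves R′) (subst (Before j i) (leaves-map g R′) c₂)
  ... | i′ , j′ , refl , refl , b₁ | _ , _ , e₁ , e₂ , b₂ with inj e₁ | inj e₂
  ... | refl | refl = nc i′ j′ (b₁ , b₂)

layouts : BT A → List (List A)
layouts (leaf x) = (x ∷ []) ∷ []
layouts (node u d) = concatMap (λ σ → concatMap (λ τ → (σ ++ τ) ∷ (τ ++ σ) ∷ []) (layouts d)) (layouts u)

Layout⇒∈layouts : {t : BT A} {σ : List A} → Layout t σ → σ ∈ₗ layouts t
Layout⇒∈layouts leaf = here refl
Layout⇒∈layouts (node {u} {d} l₁ l₂) =
  ∈-concatMap⁺ _ {xs = layouts u}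
      (Any.map (λ { refl → ∈-concatMap⁺ _ {xs = layouts d} (Any.map (λ { refl → here refl }) (Layout⇒∈layouts l₂)) }) (Layout⇒∈layouts l₁))
Layout⇒∈layouts (swap {u} {d} l₁ l₂) =
  ∈-concatMap⁺ _ {xs = layouts u}
      (Any.map (λ { refl → ∈-concatMap⁺ _ {xs = layouts d} (Any.map (λ { refl → there (here refl) }) (Layout⇒∈layouts l₂)) })
          (Layout⇒∈layouts l₁))

before? : (i j : Fin n) (xs : List (Fin n)) → Dec (Before i j xs)
before? i j [] = no λ ()
before? i j (x ∷ xs) with i ≟F x | before? i j xs
... | _ | yes b = yes (there b)
... | no i≢x | no ¬b = no λ { (here _) → i≢x refl ; (there b) → ¬b b }
... | yes refl | no ¬b with Any.any? (j ≟F_) xs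
...   | yes m = yes (here m)
...   | no j∉xs = no λ { (here m) → j∉xs m ; (there b) → ¬b b }

HasCrossing : List (Fin n) → List (Fin n) → Set
HasCrossing {n} σ ρ = Σ[ i ∈ Fin n ] Σ[ j ∈ Fin n ] (Before i j σ × Before j i ρ)

hasCrossing? : (σ ρ : List (Fin n)) → Dec (HasCrossing σ ρ)
hasCrossing? σ ρ = any? λ i → any? λ j → before? i j σ ×-dec before? j i ρ

AlwaysCrossing : (L₁ R₁ : Tree n) → Set
AlwaysCrossing L₁ R₁ = All (λ σ → All (λ ρ → HasCrossing σ ρ) (layouts R₁)) (layouts L₁)

alwaysCrossing? : (L₁ R₁ : Tree n) → Dec (AlwaysCrossing L₁ R₁)
alwaysCrossing? L₁ R₁ = All.all? (λ σ → All.all? (λ ρ → hasCrossing? σ ρ) (layouts R₁)) (layouts L₁)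

AlwaysCrossing⇒nonplanar : {L₁ R₁ : Tree n} → AlwaysCrossing L₁ R₁ → ¬ PlanarPair L₁ R₁
AlwaysCrossing⇒nonplanar ac (L′ , R′ , pL , pR , nc)
  with All.lookup (All.lookup ac (Layout⇒∈layouts (∼⇒Layout pL))) (Layout⇒∈layouts (∼⇒Layout pR))
... | i , j , b₁ , b₂ = nc i j (b₁ , b₂)

-- Decided by checking all 2³ × 2³ pairs of layouts.
T₁-nonplanar : ¬ Planar T₁
T₁-nonplanar = AlwaysCrossing⇒nonplanar (toWitness {a? = alwaysCrossing? (L T₁) (R T₁)} tt)

T₂-nonplanar : ¬ Planar T₂
T₂-nonplanar = AlwaysCrossing⇒nonplanar (toWitness {a? = alwaysCrossing? (L T₂) (R T₂)} tt)

nonplanar⇒induces-T₁-or-T₂ : (n : ℕ) (T : Tanglegram n) → ¬ Planar T → InducedSub T₁ T ⊎ InducedSub T₂ T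
nonplanar⇒induces-T₁-or-T₂ n T np =
  [ (λ c → ⊥-elim (np (CommonLayout⇒PlanarPair (uniqueˡ (Tanglegram-SameLeaves T)) c))) , (λ o → o) ]′ (dichotomy (Tanglegram-SameLeaves T))

ProperSubtanglegramsPlanar : Tanglegram n → Set
ProperSubtanglegramsPlanar {n} T = ∀ (E : Subset n) (L′ R′ : Tree n) → (∃[ i ] i ∉ E) →
  restrict E (L T) ≡ just L′ → restrict E (R T) ≡ just R′ → PlanarPair L′ R′

-- The induced copy cannot omit a matching edge (that copy would be planar), so it is all of T.
critical⇒≅ : {k : ℕ} (T′ : Tanglegram k) → ¬ Planar T′ → (T : Tanglegram n) → ProperSubtanglegramsPlanar T → Induces T′ (L T) (R T) → T ≅ T′
critical⇒≅ {n} T′ np′ T sub (E , f , inj , f∈E , onto , (L₀ , eL , sL) , (R₀ , eR , sR)) with find-∉ E (allFin n)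
... | inj₁ (i , _ , i∉E) = ⊥-elim (np′ (PlanarPair-map⁻ f (PlanarPair-resp-∼ (∼-sym sL) (∼-sym sR) (sub E L₀ R₀ (i , i∉E) eL eR))))
... | inj₂ all∈E with just-injective (trans (sym (restrict-⊇ E (L T) (λ z _ → all∈E z (∈-allFin z)))) eL)
                    | just-injective (trans (sym (restrict-⊇ E (R T) (λ z _ → all∈E z (∈-allFin z)))) eR)
... | refl | refl = mk↔ₛ′ f⁻¹ f f⁻¹∘f f∘f⁻¹ , relabel sL , relabel sR
  where
  f⁻¹ : Fin n → Fin _
  f⁻¹ i = proj₁ (onto i (all∈E i (∈-allFin i)))
  f∘f⁻¹ : ∀ i → f (f⁻¹ i) ≡ i
  f∘f⁻¹ i = proj₂ (onto i (all∈E i (∈-allFin i)))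
  f⁻¹∘f : ∀ j → f⁻¹ (f j) ≡ j
  f⁻¹∘f j = inj (f∘f⁻¹ (f j))
  relabel : {t : Tree n} {t′ : BT (Fin _)} → map f t′ ∼ t → map f⁻¹ t ∼ t′
  relabel {t′ = t′} s = ∼-sym (subst (_∼ _) (map-inverse f⁻¹ f f⁻¹∘f t′) (map-resp-∼ f⁻¹ s))

↔-to-injective : {m : ℕ} (π : Fin n ↔ Fin m) → Injective _≡_ _≡_ (Inverse.to π)
↔-to-injective π {x} {y} e =
  trans (sym (Inverse.strictlyInverseʳ π x)) (trans (cong (Inverse.from π) e) (Inverse.strictlyInverseʳ π y))

injection-missing-point : {k : ℕ} (π : Fin n ↔ Fin (suc k)) (i : Fin n) (g : Fin (suc k) → Fin n) →
  Injective _≡_ _≡_ g → (∀ j → g j ≢ i) → ⊥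
injection-missing-point π i g g-inj g≢i = no-collision (pigeonhole ≤-refl (λ j → punchOut (to-i≢ j)))
  where
  to-i≢ : ∀ j → Inverse.to π i ≢ Inverse.to π (g j)
  to-i≢ j e = g≢i j (sym (↔-to-injective π e))
  no-collision : ¬ ∃₂ λ a b → a <ᶠ b × punchOut (to-i≢ a) ≡ punchOut (to-i≢ b)
  no-collision (a , b , a<b , e) = <⇒≢ a<b (g-inj (↔-to-injective π (punchOut-injective (to-i≢ a) (to-i≢ b) e)))

-- A proper restriction of a tanglegram of size k has fewer than k leaves, so it cannot induce one of size k.
≅-proper-not-Induces : {k : ℕ} (T′ T″ : Tanglegram (suc k)) (T : Tanglegram n) → T ≅ T′ → (E : Subset n) (i : Fin n) → i ∉ E →
  {L′ R′ : Tree n} → restrict E (L T) ≡ just L′ → ¬ Induces T″ L′ R′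
≅-proper-not-Induces T′ T″ T (π , _) E i i∉E {L′} eL (E₀ , g , g-inj , _ , _ , (L₀ , eL₀ , sL₀) , _) =
  injection-missing-point π i g g-inj λ j g≡i → i∉E (subst (_∈ E) g≡i (g∈E j))
  where
  g∈E : ∀ j → g j ∈ E
  g∈E j = proj₂ (restrict-∈⁻ E (L T) L′ eL (proj₁ (restrict-∈⁻ E₀ L′ L₀ eL₀ (∼-∈ sL₀ (leaves-map-∈ g (L T″) (L-∋ T″ j))))))

≅⇒critical : (T′ : Tanglegram 4) → ¬ Planar T′ → (T : Tanglegram n) → T ≅ T′ → CrossingCritical T
≅⇒critical T′ np′ T iso@(π , pL , pR) = nonplanar , proper-planar
  where
  nonplanar : ¬ Planar T
  nonplanar p = np′ (PlanarPair-resp-∼ pL pR (PlanarPair-map (Inverse.to π) (↔-to-injective π) p))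
  proper-planar : ProperSubtanglegramsPlanar T
  proper-planar E L′ R′ (i , i∉E) eL eR with dichotomy (SameLeaves-restrict E (Tanglegram-SameLeaves T) eL eR)
  ... | inj₁ c = CommonLayout⇒PlanarPair (uniqueˡ (SameLeaves-restrict E (Tanglegram-SameLeaves T) eL eR)) c
  ... | inj₂ (inj₁ o) = ⊥-elim (≅-proper-not-Induces T′ T₁ T iso E i i∉E {L′} {R′} eL o)
  ... | inj₂ (inj₂ o) = ⊥-elim (≅-proper-not-Induces T′ T₂ T iso E i i∉E {L′} {R′} eL o)

critical⇔≅ : (n : ℕ) (T : Tanglegram n) → CrossingCritical T ⇔ (T ≅ T₁ ⊎ T ≅ T₂)
critical⇔≅ n T = mk⇔ critical⇒ ≅⇒
  where
  critical⇒ : CrossingCritical T → T ≅ T₁ ⊎ T ≅ T₂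
  critical⇒ (np , sub) = Sum.map (critical⇒≅ T₁ T₁-nonplanar T sub) (critical⇒≅ T₂ T₂-nonplanar T sub) (nonplanar⇒induces-T₁-or-T₂ n T np)
  ≅⇒ : T ≅ T₁ ⊎ T ≅ T₂ → CrossingCritical T
  ≅⇒ = [ ≅⇒critical T₁ T₁-nonplanar T , ≅⇒critical T₂ T₂-nonplanar T ]′

theorem1 : ((n : ℕ) (T : Tanglegram n) → CrossingCritical T ⇔ (T ≅ T₁ ⊎ T ≅ T₂))
    × ((n : ℕ) (T : Tanglegram n) → ¬ Planar T → InducedSub T₁ T ⊎ InducedSub T₂ T)
theorem1 = critical⇔≅ , nonplanar⇒induces-T₁-or-T₂
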